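{- For an integer $n\ge0$, let \[ f_{1,n}(t,y)=\frac{n!\,e^{t+y}}{(1+e^t+e^y-e^{t+y})^{n+1}},\qquad f_{2,n}(t,y)=\frac{n!\,e^{ -t+y}}{(1+e^{ -t}+e^y-e^{ -t+y})^{n+1}}. \] Then for every integer $n\ge0$, \[ f_{1,n}(t,y)+f_{2,n}(t,y)=\sum_{m=0}^{\infty}\sum_{l=0}^{\infty}\mathscr{D}_m^{(-l)}(n)\frac{t^m}{m!}\frac{y^l}{l!}. \]
   Context: For $k\in\mathbb{Z}$ and $|z|<1$, let $\mathrm{Li}_k(z)=\sum_{n\ge1}z^n/n^k$. The unsigned Stirling numbers of the first kind $\left[{n\atop j}\right]$ are defined by $x(x+1)\cdots(x+n-1)=\sum_{j=0}^n\left[{n\atop j}\right]x^j$. For integers $l,n\ge0$, define $D_m^{(-l)}(n)$ by \[ \frac12(e^t+1)^{1-n}\frac{\mathrm{Li}_{ -l}(\tanh(t/2))}{\sinh t}+\frac12(e^{ -t}+1)^{1-n}\frac{\mathrm{Li}_{ -l}(-\tanh(t/2))}{\sinh(-t)}=\sum_{m\ge0}D_m^{(-l)}(n)\frac{t^m}{m!}. \] The symmetrized polycosecant numbers are \[ \mathscr{D}_m^{(-l)}(n)=\sum_{j=0}^n\left[{n\atop j}\right]D_m^{(-l-j)}(n). \] -}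

module Defs where

open import Data.Nat as ℕ using (ℕ; zero; suc)
open import Data.Nat using (_!)
open import Data.Integer as ℤ using (ℤ)
open import Data.Rational using (ℚ; 0ℚ; 1ℚ; _+_; _*_; -_; _-_; 1/_; ≢-nonZero)
open import Data.Rational.Properties using (_≟_)
open import Data.List using (List; []; _∷_)
open import Relation.Nullary using (yes; no)

ℕ→ℚ : ℕ → ℚ
ℕ→ℚ k = ℤ.+ k Data.Rational./ 1

_^ℚ_ : ℚ → ℕ → ℚ
q ^ℚ zero  = 1ℚ
q ^ℚ suc k = q * (q ^ℚ k)

-- total reciprocal: 1/q for q ≠ 0 (only ever used at nonzero q)
recip : ℚ → ℚ
recip q with q ≟ 0ℚ
... | yes _ = 0ℚ
... | no q≢0 = 1/_ q {{≢-nonZero q≢0}}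

Σ< : ℕ → (ℕ → ℚ) → ℚ
Σ< zero    f = 0ℚ
Σ< (suc n) f = Σ< n f + f n

Σ≤ : ℕ → (ℕ → ℚ) → ℚ
Σ≤ n = Σ< (suc n)

-- Unsigned Stirling numbers of the first kind, as coefficients of the
-- rising factorial x(x+1)...(x+n-1); polynomials are coefficient lists
-- (index = degree).

Poly : Set
Poly = List ℕ

padd : Poly → Poly → Poly
padd []       q        = q
padd p        []       = p
padd (a ∷ p)  (b ∷ q)  = (a ℕ.+ b) ∷ padd p q

pscale : ℕ → Poly → Poly
pscale c []      = []
pscale c (a ∷ p) = (c ℕ.* a) ∷ pscale c p

mulLin : ℕ → Poly → Poly
mulLin c p = padd (pscale c p) (0 ∷ p)

rising : ℕ → Poly
rising zero    = 1 ∷ []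
rising (suc n) = mulLin n (rising n)

coeff : Poly → ℕ → ℕ
coeff []      _       = 0
coeff (a ∷ p) zero    = a
coeff (a ∷ p) (suc j) = coeff p j

stirling1 : ℕ → ℕ → ℕ
stirling1 n j = coeff (rising n) j

-- Formal power series in one variable t over ℚ : coefficient of t^m

Ser : Set
Ser = ℕ → ℚ

infixl 6 _⊕_ _⊖_
infixl 7 _⊛_

const : ℚ → Ser
const c zero    = c
const c (suc _) = 0ℚ

_⊕_ : Ser → Ser → Ser
(f ⊕ g) m = f m + g m

_⊖_ : Ser → Ser → Ser
(f ⊖ g) m = f m - g m

scal : ℚ → Ser → Ser
scal c f m = c * f m

_⊛_ : Ser → Ser → Ser
(f ⊛ g) m = Σ≤ m (λ i → f i * g (m ℕ.∸ i))

pow : Ser → ℕ → Ser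
pow f zero    = const 1ℚ
pow f (suc k) = f ⊛ pow f k

-- multiplicative inverse of a series with nonzero constant term c:
-- 1/f = (1/c) Σ_k h^k with h = 1 - f/c (h has zero constant term, so
-- only k ≤ m contributes to the coefficient of t^m)
inv : Ser → Ser
inv f m = recip (f 0) * Σ≤ m (λ k → pow h k m)
  where h = const 1ℚ ⊖ scal (recip (f 0)) f

expS : ℚ → Ser
expS a m = (a ^ℚ m) * recip (ℕ→ℚ (m !))

negArg : Ser → Ser
negArg f m = ((- 1ℚ) ^ℚ m) * f m

-- f(t)/t, for f with zero constant term
divT : Ser → Ser
divT f m = f (suc m)

-- Li_{-l}(g(t)) = Σ_{k≥1} k^l g(t)^k, for g with zero constant term
-- (only k ≤ m contributes to the coefficient of t^m)
LiNeg : ℕ → Ser → Ser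
LiNeg l g m = Σ≤ m (λ k → (ℕ→ℚ k ^ℚ l) * pow g k m)

-- e^t, e^t + 1, tanh(t/2) = (e^t - 1)/(e^t + 1), sinh t
eT : Ser
eT = expS 1ℚ

eT+1 : Ser
eT+1 = eT ⊕ const 1ℚ

tanhHalf : Ser
tanhHalf = (eT ⊖ const 1ℚ) ⊛ inv eT+1

sinhS : Ser
sinhS = scal (recip (ℕ→ℚ 2)) (eT ⊖ expS (- 1ℚ))

eT+1^1-n : ℕ → Ser
eT+1^1-n zero    = eT+1
eT+1^1-n (suc k) = inv (pow eT+1 k)

-- g / sinh t = (g/t) * (t / sinh t), for g with zero constant term
divSinh : Ser → Ser
divSinh g = divT g ⊛ inv (divT sinhS)

Aterm : ℕ → ℕ → Ser
Aterm l n = scal (recip (ℕ→ℚ 2)) (eT+1^1-n n ⊛ divSinh (LiNeg l tanhHalf))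

-- generating function of D_m^{(-l)}(n) : A(t) + A(-t)
-- (note 1/2 (e^{-t}+1)^{1-n} Li_{-l}(-tanh(t/2)) / sinh(-t) = A(-t))
Dgen : ℕ → ℕ → Ser
Dgen l n = Aterm l n ⊕ negArg (Aterm l n)

D : ℕ → ℕ → ℕ → ℚ
D m l n = ℕ→ℚ (m !) * Dgen l n m

𝒟 : ℕ → ℕ → ℕ → ℚ
𝒟 m l n = Σ≤ n (λ j → ℕ→ℚ (stirling1 n j) * D m (l ℕ.+ j) n)

-- Formal power series in two variables t, y : coefficient of t^i y^j

Ser2 : Set
Ser2 = ℕ → ℕ → ℚ

infixl 6 _⊕₂_ _⊖₂_
infixl 7 _⊛₂_

const2 : ℚ → Ser2
const2 c zero    zero    = c
const2 c _       _       = 0ℚ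

_⊕₂_ : Ser2 → Ser2 → Ser2
(f ⊕₂ g) i j = f i j + g i j

_⊖₂_ : Ser2 → Ser2 → Ser2
(f ⊖₂ g) i j = f i j - g i j

scal2 : ℚ → Ser2 → Ser2
scal2 c f i j = c * f i j

_⊛₂_ : Ser2 → Ser2 → Ser2
(f ⊛₂ g) i j = Σ≤ i (λ a → Σ≤ j (λ b → f a b * g (i ℕ.∸ a) (j ℕ.∸ b)))

pow2 : Ser2 → ℕ → Ser2
pow2 f zero    = const2 1ℚ
pow2 f (suc k) = f ⊛₂ pow2 f k

inv2 : Ser2 → Ser2
inv2 f i j = recip (f 0 0) * Σ≤ (i ℕ.+ j) (λ k → pow2 h k i j)
  where h = const2 1ℚ ⊖₂ scal2 (recip (f 0 0)) f

exp2 : ℚ → ℚ → Ser2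
exp2 a b i j = (a ^ℚ i) * recip (ℕ→ℚ (i !)) * ((b ^ℚ j) * recip (ℕ→ℚ (j !)))

fgen : ℚ → ℕ → Ser2
fgen a n = scal2 (ℕ→ℚ (n !))
  (exp2 a 1ℚ ⊛₂ inv2 (pow2 (const2 1ℚ ⊕₂ exp2 a 0ℚ ⊕₂ exp2 0ℚ 1ℚ ⊖₂ exp2 a 1ℚ) (suc n)))

f₁ : ℕ → Ser2
f₁ = fgen 1ℚ

f₂ : ℕ → Ser2
f₂ = fgen (- 1ℚ)

-- Write X = tanh(t/2). Then 1 + e^t + e^y - e^{t+y} = (e^t + 1)(1 - X e^y) and e^t sinh t = ½ (e^t + 1)² X, so
--   f₁ sinh t = ½ (e^t + 1)^{1-n} n! X e^y / (1 - X e^y)^{n+1} = ½ (e^t + 1)^{1-n} Σ_k k (k+1) ⋯ (k+n-1) X^k e^{ky}.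
-- Since [y^l] e^{ky} = k^l / l! and k (k+1) ⋯ (k+n-1) = Σ_j [n j] k^j, the y^l coefficient of f₁ is
-- (1/l!) Σ_j [n j] A_{l+j}(t) with A_L(t) = ½ (e^t + 1)^{1-n} Li_{-L}(X) / sinh t. Finally f₂(t, y) = f₁(-t, y),
-- so f₁ + f₂ symmetrizes A_L(t) into A_L(t) + A_L(-t), the generating function of the D-numbers.
module Submission where

open import Algebra.Bundles using (CommutativeRing)
import Data.Rational.Properties as ℚP

module CommutativeRingLemmas {c ℓ} (R : CommutativeRing c ℓ) where

  open import Data.Nat as ℕ using (ℕ; zero; suc; _∸_; s≤s) renaming (_+_ to _+ℕ_; _≤_ to _≤ℕ_; _<_ to _<ℕ_)
  import Data.Nat.Properties as ℕP
  open import Relation.Binary.PropositionalEquality as ≡ using (_≡_)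
  open import Relation.Nullary using (yes; no; ¬_)

  open CommutativeRing R
  open import Relation.Binary.Reasoning.Setoid setoid

  open import Algebra.Properties.Ring ring public
    using (-‿+-comm; -0#≈0#; x[y-z]≈xy-xz; [y-z]x≈yx-zx)
  open import Algebra.Properties.CommutativeSemiring.Exp commutativeSemiring public
    using (_^_; ^-homo-*; ^-congˡ; ^-distrib-*)
  open import Algebra.Properties.CommutativeSemigroup +-commutativeSemigroup public
    using () renaming (interchange to +-interchange)
  open import Algebra.Properties.CommutativeSemigroup *-commutativeSemigroup public
    using (x∙yz≈y∙xz; xy∙z≈xz∙y) renaming (interchange to *-interchange)

  Σ< : ℕ → (ℕ → Carrier) → Carrier
  Σ< zero    f = 0#
  Σ< (suc n) f = Σ< n f + f n

  Σ≤ : ℕ → (ℕ → Carrier) → Carrier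
  Σ≤ n = Σ< (suc n)

  Σ-cong : ∀ n {f g : ℕ → Carrier} → (∀ i → i <ℕ n → f i ≈ g i) → Σ< n f ≈ Σ< n g
  Σ-cong zero    e = refl
  Σ-cong (suc n) e = +-cong (Σ-cong n (λ i i<n → e i (ℕP.m<n⇒m<1+n i<n))) (e n (ℕP.n<1+n n))

  Σ-cong′ : ∀ n {f g : ℕ → Carrier} → (∀ i → f i ≈ g i) → Σ< n f ≈ Σ< n g
  Σ-cong′ n e = Σ-cong n (λ i _ → e i)

  Σ-zero : ∀ n {f : ℕ → Carrier} → (∀ i → i <ℕ n → f i ≈ 0#) → Σ< n f ≈ 0#
  Σ-zero zero    e = refl
  Σ-zero (suc n) e =
    trans (+-cong (Σ-zero n (λ i i<n → e i (ℕP.m<n⇒m<1+n i<n))) (e n (ℕP.n<1+n n))) (+-identityʳ 0#)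

  Σ-+ : ∀ n (f g : ℕ → Carrier) → Σ< n (λ i → f i + g i) ≈ Σ< n f + Σ< n g
  Σ-+ zero    f g = sym (+-identityʳ 0#)
  Σ-+ (suc n) f g = trans (+-congʳ (Σ-+ n f g)) (+-interchange _ _ _ _)

  Σ-*ˡ : ∀ n x (f : ℕ → Carrier) → x * Σ< n f ≈ Σ< n (λ i → x * f i)
  Σ-*ˡ zero    x f = zeroʳ x
  Σ-*ˡ (suc n) x f = trans (distribˡ x _ _) (+-congʳ (Σ-*ˡ n x f))

  Σ-*ʳ : ∀ n x (f : ℕ → Carrier) → Σ< n f * x ≈ Σ< n (λ i → f i * x)
  Σ-*ʳ n x f = trans (*-comm _ x) (trans (Σ-*ˡ n x f) (Σ-cong′ n (λ i → *-comm x (f i))))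

  Σ-neg : ∀ n (f : ℕ → Carrier) → - Σ< n f ≈ Σ< n (λ i → - f i)
  Σ-neg zero    f = -0#≈0#
  Σ-neg (suc n) f = trans (sym (-‿+-comm _ _)) (+-congʳ (Σ-neg n f))

  Σ-split : ∀ n k (f : ℕ → Carrier) → Σ< (n +ℕ k) f ≈ Σ< n f + Σ< k (λ i → f (n +ℕ i))
  Σ-split n zero    f = trans (reflexive (≡.cong (λ z → Σ< z f) (ℕP.+-identityʳ n))) (sym (+-identityʳ _))
  Σ-split n (suc k) f = begin
    Σ< (n +ℕ suc k) f                              ≈⟨ reflexive (≡.cong (λ z → Σ< z f) (ℕP.+-suc n k)) ⟩
    Σ< (n +ℕ k) f + f (n +ℕ k)                     ≈⟨ +-congʳ (Σ-split n k f) ⟩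
    (Σ< n f + Σ< k (λ i → f (n +ℕ i))) + f (n +ℕ k) ≈⟨ +-assoc _ _ _ ⟩
    Σ< n f + Σ< (suc k) (λ i → f (n +ℕ i))          ∎

  Σ-head : ∀ n (f : ℕ → Carrier) → Σ< (suc n) f ≈ f 0 + Σ< n (λ i → f (suc i))
  Σ-head n f = trans (Σ-split 1 n f) (+-congʳ (+-identityˡ (f 0)))

  Σ-swap : ∀ n m (f : ℕ → ℕ → Carrier) →
    Σ< n (λ i → Σ< m (λ j → f i j)) ≈ Σ< m (λ j → Σ< n (λ i → f i j))
  Σ-swap zero    m f = sym (Σ-zero m (λ _ _ → refl))
  Σ-swap (suc n) m f = trans (+-congʳ (Σ-swap n m f)) (sym (Σ-+ m _ _))

  Σ-reverse : ∀ n (f : ℕ → Carrier) → Σ< n f ≈ Σ< n (λ i → f (n ∸ suc i))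
  Σ-reverse zero    f = refl
  Σ-reverse (suc n) f = begin
    Σ< n f + f n                        ≈⟨ +-congʳ (Σ-reverse n f) ⟩
    Σ< n (λ i → f (n ∸ suc i)) + f n     ≈⟨ +-comm _ _ ⟩
    f n + Σ< n (λ i → f (n ∸ suc i))     ≈⟨ Σ-head n (λ i → f (n ∸ i)) ⟨
    Σ< (suc n) (λ i → f (suc n ∸ suc i)) ∎

  Σ-single : ∀ n k (f : ℕ → Carrier) → k <ℕ n → (∀ i → i <ℕ n → ¬ (i ≡ k) → f i ≈ 0#) → Σ< n f ≈ f k
  Σ-single (suc n) k f k<1+n z with k ℕ.≟ n
  ... | yes ≡.refl =
    trans (+-congʳ (Σ-zero n (λ i i<n → z i (ℕP.m<n⇒m<1+n i<n) (λ e → ℕP.<-irrefl e i<n)))) (+-identityˡ _)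
  ... | no k≢n = trans
    (+-cong (Σ-single n k f (ℕP.≤∧≢⇒< (ℕP.≤-pred k<1+n) k≢n) (λ i i<n → z i (ℕP.m<n⇒m<1+n i<n)))
            (z n (ℕP.n<1+n n) (λ e → k≢n (≡.sym e))))
    (+-identityʳ _)

  Σ-extend : ∀ n N (f : ℕ → Carrier) → n ≤ℕ N → (∀ i → n ≤ℕ i → f i ≈ 0#) → Σ< N f ≈ Σ< n f
  Σ-extend n N f n≤N z = begin
    Σ< N f                                        ≈⟨ reflexive (≡.cong (λ q → Σ< q f) (≡.sym (ℕP.m+[n∸m]≡n n≤N))) ⟩
    Σ< (n +ℕ (N ∸ n)) f                           ≈⟨ Σ-split n (N ∸ n) f ⟩
    Σ< n f + Σ< (N ∸ n) (λ i → f (n +ℕ i))         ≈⟨ +-congˡ (Σ-zero (N ∸ n) (λ i _ → z (n +ℕ i) (ℕP.m≤m+n n i))) ⟩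
    Σ< n f + 0#                                   ≈⟨ +-identityʳ _ ⟩
    Σ< n f                                        ∎

  Σ-triangle : ∀ m (F : ℕ → ℕ → Carrier) →
    Σ≤ m (λ a → Σ≤ a (λ b → F a b)) ≈ Σ≤ m (λ b → Σ≤ (m ∸ b) (λ c → F (b +ℕ c) b))
  Σ-triangle m F = begin
    Σ≤ m (λ a → Σ≤ a (λ b → F a b))  ≈⟨ Σ-cong (suc m) (λ a a<1+m → trans
                                         (Σ-cong (suc a) (λ b b<1+a → sym (when≤-≤ (ℕP.≤-pred b<1+a))))
                                         (sym (Σ-extend (suc a) (suc m) _ a<1+m (λ b → when≤-> {b} {a})))) ⟩
    Σ≤ m (λ a → Σ≤ m (λ b → T a b))  ≈⟨ Σ-swap (suc m) (suc m) T ⟩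
    Σ≤ m (λ b → Σ≤ m (λ a → T a b))  ≈⟨ Σ-cong (suc m) (λ b b<1+m → column b (ℕP.≤-pred b<1+m)) ⟩
    Σ≤ m (λ b → Σ≤ (m ∸ b) (λ c → F (b +ℕ c) b)) ∎
    where
    when≤ : ℕ → ℕ → Carrier → Carrier
    when≤ zero    a       x = x
    when≤ (suc b) zero    x = 0#
    when≤ (suc b) (suc a) x = when≤ b a x

    when≤-≤ : ∀ {b a x} → b ≤ℕ a → when≤ b a x ≈ x
    when≤-≤ {zero}            _       = refl
    when≤-≤ {suc b} {suc a} (s≤s b≤a) = when≤-≤ {b} {a} b≤a

    when≤-> : ∀ {b a x} → a <ℕ b → when≤ b a x ≈ 0#
    when≤-> {suc b} {zero}  _         = refl
    when≤-> {suc b} {suc a} (s≤s a<b) = when≤-> {b} {a} a<b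

    T : ℕ → ℕ → Carrier
    T a b = when≤ b a (F a b)

    column : ∀ b → b ≤ℕ m → Σ≤ m (λ a → T a b) ≈ Σ≤ (m ∸ b) (λ c → F (b +ℕ c) b)
    column b b≤m = begin
      Σ≤ m (λ a → T a b)                             ≈⟨ reflexive (≡.cong (λ q → Σ< q (λ a → T a b))
                                                         (≡.sym (ℕP.m+[n∸m]≡n (ℕP.m≤n⇒m≤1+n b≤m)))) ⟩
      Σ< (b +ℕ (suc m ∸ b)) (λ a → T a b)            ≈⟨ Σ-split b (suc m ∸ b) _ ⟩
      Σ< b (λ a → T a b) + Σ< (suc m ∸ b) (λ c → T (b +ℕ c) b)
        ≈⟨ +-cong (Σ-zero b (λ a a<b → when≤-> {b} {a} a<b))
                  (Σ-cong′ (suc m ∸ b) (λ c → when≤-≤ {b} {b +ℕ c} (ℕP.m≤m+n b c))) ⟩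
      0# + Σ< (suc m ∸ b) (λ c → F (b +ℕ c) b)       ≈⟨ +-identityˡ _ ⟩
      Σ< (suc m ∸ b) (λ c → F (b +ℕ c) b)            ≡⟨ ≡.cong (λ q → Σ< q (λ c → F (b +ℕ c) b)) (ℕP.+-∸-assoc 1 b≤m) ⟩
      Σ≤ (m ∸ b) (λ c → F (b +ℕ c) b)                ∎

  x-y+[y-z]≈x-z : ∀ a b d → (a - b) + (b - d) ≈ a - d
  x-y+[y-z]≈x-z a b d = begin
    (a - b) + (b - d)    ≈⟨ +-assoc a (- b) (b - d) ⟩
    a + (- b + (b - d))  ≈⟨ +-congˡ (+-assoc (- b) b (- d)) ⟨
    a + ((- b + b) - d)  ≈⟨ +-congˡ (+-congʳ (-‿inverseˡ b)) ⟩
    a + (0# - d)         ≈⟨ +-congˡ (+-identityˡ (- d)) ⟩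
    a - d                ∎

  difference-of-squares : ∀ a b → (a + b) * (a - b) ≈ a * a - b * b
  difference-of-squares a b = begin
    (a + b) * (a - b)                      ≈⟨ distribʳ (a - b) a b ⟩
    a * (a - b) + b * (a - b)              ≈⟨ +-cong (x[y-z]≈xy-xz a a b) (x[y-z]≈xy-xz b a b) ⟩
    (a * a - a * b) + (b * a - b * b)      ≈⟨ +-congˡ (+-congʳ (*-comm b a)) ⟩
    (a * a - a * b) + (a * b - b * b)      ≈⟨ x-y+[y-z]≈x-z (a * a) (a * b) (b * b) ⟩
    a * a - b * b                          ∎

  geometric-telescope : ∀ h K → (1# - h) * Σ< K (h ^_) ≈ 1# - h ^ K
  geometric-telescope h zero    = trans (zeroʳ _) (sym (-‿inverseʳ 1#))
  geometric-telescope h (suc K) = begin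
    (1# - h) * (Σ< K (h ^_) + h ^ K)              ≈⟨ distribˡ (1# - h) _ _ ⟩
    (1# - h) * Σ< K (h ^_) + (1# - h) * h ^ K     ≈⟨ +-cong (geometric-telescope h K) ([y-z]x≈yx-zx (h ^ K) 1# h) ⟩
    (1# - h ^ K) + (1# * h ^ K - h * h ^ K)       ≈⟨ +-congˡ (+-congʳ (*-identityˡ _)) ⟩
    (1# - h ^ K) + (h ^ K - h ^ suc K)            ≈⟨ x-y+[y-z]≈x-z 1# (h ^ K) (h ^ suc K) ⟩
    1# - h ^ suc K                                ∎

module PowerSeries {c ℓ} (R : CommutativeRing c ℓ) where

  open import Data.Nat using (ℕ; zero; suc; _∸_; z≤n; s≤s) renaming (_+_ to _+ℕ_; _≤_ to _≤ℕ_; _<_ to _<ℕ_)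
  import Data.Nat.Properties as ℕP
  open import Data.Product using (_,_)
  open import Data.Empty using (⊥-elim)
  open import Relation.Binary.PropositionalEquality as ≡ using (_≡_)
  open import Relation.Nullary using (yes; no; ¬_)
  import Relation.Binary.Reasoning.Setoid as SetoidReasoning

  open CommutativeRing R hiding (ring)
  open SetoidReasoning setoid
  open CommutativeRingLemmas R public

  Series : Set c
  Series = ℕ → Carrier

  infix 4 _≋_
  record _≋_ (f g : Series) : Set ℓ where
    constructor mk
    field at : ∀ m → f m ≈ g m
  open _≋_ public

  ≋-refl : ∀ {f} → f ≋ f
  ≋-refl = mk λ m → refl

  ≋-sym : ∀ {f g} → f ≋ g → g ≋ f
  ≋-sym e = mk λ m → sym (at e m)

  ≋-trans : ∀ {f g h} → f ≋ g → g ≋ h → f ≋ h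
  ≋-trans e e′ = mk λ m → trans (at e m) (at e′ m)

  infixl 6 _⊕_ _⊖_
  infixl 7 _⊛_

  const : Carrier → Series
  const x zero    = x
  const x (suc _) = 0#

  _⊕_ : Series → Series → Series
  (f ⊕ g) m = f m + g m

  _⊖_ : Series → Series → Series
  (f ⊖ g) m = f m - g m

  neg : Series → Series
  neg f m = - f m

  scal : Carrier → Series → Series
  scal x f m = x * f m

  opaque
    _⊛_ : Series → Series → Series
    (f ⊛ g) m = Σ≤ m (λ i → f i * g (m ∸ i))

  pow : Series → ℕ → Series
  pow f zero    = const 1#
  pow f (suc k) = f ⊛ pow f k

  negArg : Series → Series
  negArg f m = ((- 1#) ^ m) * f m

  const-0# : ∀ m → const 0# m ≈ 0#
  const-0# zero    = refl
  const-0# (suc m) = refl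

  HasOrder : ℕ → Series → Set ℓ
  HasOrder k f = ∀ i → i <ℕ k → f i ≈ 0#

  opaque
    unfolding _⊛_

    ⊛-coeff : ∀ f g m → (f ⊛ g) m ≡ Σ≤ m (λ i → f i * g (m ∸ i))
    ⊛-coeff f g m = ≡.refl

    ⊛-local : ∀ m {f f′ g g′} → (∀ i → i ≤ℕ m → f i ≈ f′ i) → (∀ i → i ≤ℕ m → g i ≈ g′ i) →
      (f ⊛ g) m ≈ (f′ ⊛ g′) m
    ⊛-local m ef eg =
      Σ-cong (suc m) (λ i i<1+m → *-cong (ef i (ℕP.≤-pred i<1+m)) (eg (m ∸ i) (ℕP.m∸n≤m m i)))

    ⊛-comm : ∀ f g → f ⊛ g ≋ g ⊛ f
    ⊛-comm f g = mk λ m → begin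
      Σ≤ m (λ i → f i * g (m ∸ i))              ≈⟨ Σ-reverse (suc m) _ ⟩
      Σ≤ m (λ i → f (m ∸ i) * g (m ∸ (m ∸ i)))  ≈⟨ Σ-cong (suc m) (λ i i<1+m → trans (*-comm _ _)
                                                    (*-congʳ (reflexive (≡.cong g (ℕP.m∸[m∸n]≡n (ℕP.≤-pred i<1+m)))))) ⟩
      Σ≤ m (λ i → g i * f (m ∸ i))              ∎

    const-⊛ : ∀ x f → const x ⊛ f ≋ scal x f
    const-⊛ x f = mk λ m → Σ-single (suc m) 0 _ (s≤s z≤n) (higher m)
      where
      higher : ∀ m i → i <ℕ suc m → ¬ (i ≡ 0) → const x i * f (m ∸ i) ≈ 0#
      higher m zero    _ i≢0 = ⊥-elim (i≢0 ≡.refl)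
      higher m (suc i) _ _   = zeroˡ _

    ⊛-distribˡ : ∀ f g h → f ⊛ (g ⊕ h) ≋ f ⊛ g ⊕ f ⊛ h
    ⊛-distribˡ f g h = mk λ m → trans (Σ-cong′ (suc m) (λ i → distribˡ (f i) _ _)) (Σ-+ (suc m) _ _)

    ⊛-assoc : ∀ f g h → (f ⊛ g) ⊛ h ≋ f ⊛ (g ⊛ h)
    ⊛-assoc f g h = mk λ m → begin
      Σ≤ m (λ a → Σ≤ a (λ b → f b * g (a ∸ b)) * h (m ∸ a))
        ≈⟨ Σ-cong′ (suc m) (λ a → Σ-*ʳ (suc a) _ _) ⟩
      Σ≤ m (λ a → Σ≤ a (λ b → f b * g (a ∸ b) * h (m ∸ a)))
        ≈⟨ Σ-triangle m _ ⟩
      Σ≤ m (λ b → Σ≤ (m ∸ b) (λ c → f b * g (b +ℕ c ∸ b) * h (m ∸ (b +ℕ c))))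
        ≈⟨ Σ-cong (suc m) (λ b _ → Σ-cong′ (suc (m ∸ b)) (λ c → trans (*-assoc _ _ _)
             (*-congˡ (*-cong (reflexive (≡.cong g (ℕP.m+n∸m≡n b c)))
                              (reflexive (≡.cong h (≡.sym (ℕP.∸-+-assoc m b c)))))))) ⟩
      Σ≤ m (λ b → Σ≤ (m ∸ b) (λ c → f b * (g c * h (m ∸ b ∸ c))))
        ≈⟨ Σ-cong′ (suc m) (λ b → sym (Σ-*ˡ (suc (m ∸ b)) (f b) _)) ⟩
      Σ≤ m (λ b → f b * (g ⊛ h) (m ∸ b)) ∎

    scal-⊛ : ∀ x f g → scal x (f ⊛ g) ≋ scal x f ⊛ g
    scal-⊛ x f g = mk λ m → trans (Σ-*ˡ (suc m) x _) (Σ-cong′ (suc m) (λ i → sym (*-assoc _ _ _)))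

    ⊛-scal : ∀ x f g → f ⊛ scal x g ≋ scal x (f ⊛ g)
    ⊛-scal x f g = mk λ m → trans (Σ-cong′ (suc m) (λ i → x∙yz≈y∙xz (f i) x _)) (sym (Σ-*ˡ (suc m) x _))

    ⊛-HasOrder : ∀ a b {f g} → HasOrder a f → HasOrder b g → HasOrder (a +ℕ b) (f ⊛ g)
    ⊛-HasOrder a b {f} {g} of og m m<a+b = Σ-zero (suc m) term
      where
      term : ∀ i → i <ℕ suc m → f i * g (m ∸ i) ≈ 0#
      term i i<1+m with i ℕP.<? a
      ... | yes i<a = trans (*-congʳ (of i i<a)) (zeroˡ _)
      ... | no  i≮a = trans (*-congˡ (og (m ∸ i) m-i<b)) (zeroʳ _)
        where
        m-i<b : m ∸ i <ℕ b
        m-i<b = ℕP.+-cancelˡ-< a (m ∸ i) b (ℕP.≤-<-trans (ℕP.+-monoˡ-≤ (m ∸ i) (ℕP.≮⇒≥ i≮a))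
          (≡.subst (_<ℕ a +ℕ b) (≡.sym (ℕP.m+[n∸m]≡n (ℕP.≤-pred i<1+m))) m<a+b))

    negArg-⊛ : ∀ f g → negArg (f ⊛ g) ≋ negArg f ⊛ negArg g
    negArg-⊛ f g = mk λ m → trans (Σ-*ˡ (suc m) _ _) (Σ-cong (suc m) (λ i i<1+m → trans
      (*-congʳ (trans (reflexive (≡.cong ((- 1#) ^_) (≡.sym (ℕP.m+[n∸m]≡n (ℕP.≤-pred i<1+m)))))
                      (^-homo-* (- 1#) i (m ∸ i))))
      (*-interchange _ _ _ _)))

  ⊕-cong : ∀ {f f′ g g′} → f ≋ f′ → g ≋ g′ → f ⊕ g ≋ f′ ⊕ g′
  ⊕-cong ef eg = mk λ m → +-cong (at ef m) (at eg m)

  ⊖-cong : ∀ {f f′ g g′} → f ≋ f′ → g ≋ g′ → f ⊖ g ≋ f′ ⊖ g′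
  ⊖-cong ef eg = mk λ m → +-cong (at ef m) (-‿cong (at eg m))

  scal-cong : ∀ x {f g} → f ≋ g → scal x f ≋ scal x g
  scal-cong x e = mk λ m → *-congˡ (at e m)

  ⊛-cong : ∀ {f f′ g g′} → f ≋ f′ → g ≋ g′ → f ⊛ g ≋ f′ ⊛ g′
  ⊛-cong ef eg = mk λ m → ⊛-local m (λ i _ → at ef i) (λ i _ → at eg i)

  ⊛-identityˡ : ∀ f → const 1# ⊛ f ≋ f
  ⊛-identityˡ f = ≋-trans (const-⊛ 1# f) (mk λ m → *-identityˡ (f m))

  ⊛-identityʳ : ∀ f → f ⊛ const 1# ≋ f
  ⊛-identityʳ f = ≋-trans (⊛-comm f _) (⊛-identityˡ f)

  ⊛-distribʳ : ∀ f g h → (g ⊕ h) ⊛ f ≋ g ⊛ f ⊕ h ⊛ f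
  ⊛-distribʳ f g h = mk λ m → trans (at (⊛-comm (g ⊕ h) f) m)
    (trans (at (⊛-distribˡ f g h) m) (+-cong (at (⊛-comm f g) m) (at (⊛-comm f h) m)))

  ⊛-zeroˡ : ∀ f → const 0# ⊛ f ≋ const 0#
  ⊛-zeroˡ f = ≋-trans (const-⊛ 0# f) (mk λ m → trans (zeroˡ (f m)) (sym (const-0# m)))

  ring : CommutativeRing c ℓ
  ring = record
    { Carrier = Series ; _≈_ = _≋_ ; _+_ = _⊕_ ; _*_ = _⊛_ ; -_ = neg ; 0# = const 0# ; 1# = const 1#
    ; isCommutativeRing = record
      { isRing = record
        { +-isAbelianGroup = record
          { isGroup = record
            { isMonoid = record
              { isSemigroup = record
                { isMagma = record
                  { isEquivalence = record { refl = ≋-refl ; sym = ≋-sym ; trans = ≋-trans }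
                  ; ∙-cong = λ e e′ → mk λ m → +-cong (at e m) (at e′ m) }
                ; assoc = λ f g h → mk λ m → +-assoc (f m) (g m) (h m) }
              ; identity = (λ f → mk λ m → trans (+-congʳ (const-0# m)) (+-identityˡ (f m)))
                         , (λ f → mk λ m → trans (+-congˡ (const-0# m)) (+-identityʳ (f m))) }
            ; inverse = (λ f → mk λ m → trans (-‿inverseˡ (f m)) (sym (const-0# m)))
                      , (λ f → mk λ m → trans (-‿inverseʳ (f m)) (sym (const-0# m)))
            ; ⁻¹-cong = λ e → mk λ m → -‿cong (at e m) }
          ; comm = λ f g → mk λ m → +-comm (f m) (g m) }
        ; *-cong = ⊛-cong
        ; *-assoc = ⊛-assoc
        ; *-identity = ⊛-identityˡ , ⊛-identityʳ
        ; distrib = ⊛-distribˡ , ⊛-distribʳ }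
      ; *-comm = ⊛-comm } }

  module Ring = CommutativeRingLemmas ring
  module ≋-Reasoning = SetoidReasoning (CommutativeRing.setoid ring)

  const-cong : ∀ {x y} → x ≈ y → const x ≋ const y
  const-cong e = mk λ { zero → e ; (suc m) → refl }

  const-+ : ∀ x y → const (x + y) ≋ const x ⊕ const y
  const-+ x y = mk λ { zero → refl ; (suc m) → sym (+-identityʳ 0#) }

  const-neg : ∀ x → const (- x) ≋ neg (const x)
  const-neg x = mk λ { zero → refl ; (suc m) → sym -0#≈0# }

  const-⊛-const : ∀ x y → const x ⊛ const y ≋ const (x * y)
  const-⊛-const x y = ≋-trans (const-⊛ x (const y)) (mk λ { zero → refl ; (suc m) → zeroʳ x })

  pow-cong : ∀ {f g} k → f ≋ g → pow f k ≋ pow g k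
  pow-cong zero    e = ≋-refl
  pow-cong (suc k) e = ⊛-cong e (pow-cong k e)

  pow-+ : ∀ f a b → pow f (a +ℕ b) ≋ pow f a ⊛ pow f b
  pow-+ f zero    b = ≋-sym (⊛-identityˡ _)
  pow-+ f (suc a) b = ≋-trans (⊛-cong ≋-refl (pow-+ f a b)) (≋-sym (⊛-assoc _ _ _))

  pow-⊛ : ∀ f g k → pow (f ⊛ g) k ≋ pow f k ⊛ pow g k
  pow-⊛ f g zero    = ≋-sym (⊛-identityˡ _)
  pow-⊛ f g (suc k) = ≋-trans (⊛-cong ≋-refl (pow-⊛ f g k)) (Ring.*-interchange _ _ _ _)

  pow-HasOrder : ∀ {h} → HasOrder 1 h → ∀ k → HasOrder k (pow h k)
  pow-HasOrder oh zero    i ()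
  pow-HasOrder oh (suc k) = ⊛-HasOrder 1 k oh (pow-HasOrder oh k)

  inverse-unique : ∀ f g g′ → f ⊛ g ≋ const 1# → f ⊛ g′ ≋ const 1# → g ≋ g′
  inverse-unique f g g′ e e′ =
    ≋-trans (≋-sym (⊛-identityʳ g)) (≋-trans (⊛-cong ≋-refl (≋-sym e′)) (≋-trans (≋-sym (⊛-assoc g f g′))
      (≋-trans (⊛-cong (≋-trans (⊛-comm g f) e) ≋-refl) (⊛-identityˡ g′))))

  ^≋pow : ∀ h k → h Ring.^ k ≋ pow h k
  ^≋pow h zero    = ≋-refl
  ^≋pow h (suc k) = ⊛-cong ≋-refl (^≋pow h k)

  Σ-coeff : ∀ K (F : ℕ → Series) m → Ring.Σ< K F m ≈ Σ< K (λ k → F k m)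
  Σ-coeff zero    F m = const-0# m
  Σ-coeff (suc K) F m = +-congʳ (Σ-coeff K F m)

  geometric : Series → Series
  geometric h m = Σ≤ m (λ k → pow h k m)

  -- Coefficient m only sees the terms h^k with k ≤ m, so it may be computed from the
  -- finite geometric sum Σ_{k < m+2} h^k, whose product with 1 - h telescopes.
  geometric-inverse : ∀ h → HasOrder 1 h → (const 1# ⊖ h) ⊛ geometric h ≋ const 1#
  geometric-inverse h oh = mk λ m → begin
    ((const 1# ⊖ h) ⊛ geometric h) m      ≈⟨ ⊛-local m (λ _ _ → refl) (λ j j≤m → truncation m j j≤m) ⟩
    ((const 1# ⊖ h) ⊛ G m) m              ≈⟨ at (Ring.geometric-telescope h (2 +ℕ m)) m ⟩
    const 1# m - (h Ring.^ (2 +ℕ m)) m    ≈⟨ +-congˡ (-‿cong (trans (at (^≋pow h (2 +ℕ m)) m)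
                                               (pow-HasOrder oh (2 +ℕ m) m (ℕP.m<n⇒m<1+n (ℕP.n<1+n m))))) ⟩
    const 1# m - 0#                       ≈⟨ +-congˡ -0#≈0# ⟩
    const 1# m + 0#                       ≈⟨ +-identityʳ _ ⟩
    const 1# m                            ∎
    where
    G : ℕ → Series
    G m = Ring.Σ< (2 +ℕ m) (h Ring.^_)

    truncation : ∀ m j → j ≤ℕ m → geometric h j ≈ G m j
    truncation m j j≤m = sym (trans (Σ-coeff (2 +ℕ m) _ j) (trans (Σ-cong′ (2 +ℕ m) (λ k → at (^≋pow h k) j))
      (Σ-extend (suc j) (2 +ℕ m) _ (s≤s (ℕP.m≤n⇒m≤1+n j≤m)) (λ k → pow-HasOrder oh k j))))

  negArg-cong : ∀ {f g} → f ≋ g → negArg f ≋ negArg g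
  negArg-cong e = mk λ m → *-congˡ (at e m)

  negArg-const : ∀ x → negArg (const x) ≋ const x
  negArg-const x = mk λ { zero → *-identityˡ x ; (suc m) → zeroʳ _ }

  negArg-pow : ∀ f k → negArg (pow f k) ≋ pow (negArg f) k
  negArg-pow f zero    = negArg-const 1#
  negArg-pow f (suc k) = ≋-trans (negArg-⊛ f _) (⊛-cong ≋-refl (negArg-pow f k))

  negArg-inverse : ∀ {f g} → f ⊛ g ≋ const 1# → negArg f ⊛ negArg g ≋ const 1#
  negArg-inverse {f} {g} fg≋1 = ≋-trans (≋-sym (negArg-⊛ f g)) (≋-trans (negArg-cong fg≋1) (negArg-const 1#))

  -- Σ_k F k for families with HasOrder k (F k): only k ≤ m contribute to coefficient m.
  Σ∞ : (ℕ → Series) → Series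
  Σ∞ F m = Σ≤ m (λ k → F k m)

  Σ∞-cong : ∀ {F G} → (∀ k → F k ≋ G k) → Σ∞ F ≋ Σ∞ G
  Σ∞-cong e = mk λ m → Σ-cong′ (suc m) (λ k → at (e k) m)

  Σ∞-⊕ : ∀ F G → Σ∞ (λ k → F k ⊕ G k) ≋ Σ∞ F ⊕ Σ∞ G
  Σ∞-⊕ F G = mk λ m → Σ-+ (suc m) _ _

  Σ∞-neg : ∀ F → Σ∞ (λ k → neg (F k)) ≋ neg (Σ∞ F)
  Σ∞-neg F = mk λ m → sym (Σ-neg (suc m) _)

  Σ∞-⊛ : ∀ F g → (∀ k → HasOrder k (F k)) → Σ∞ F ⊛ g ≋ Σ∞ (λ k → F k ⊛ g)
  Σ∞-⊛ F g oF = mk λ m → begin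
    (Σ∞ F ⊛ g) m                                   ≡⟨ ⊛-coeff (Σ∞ F) g m ⟩
    Σ≤ m (λ a → Σ≤ a (λ k → F k a) * g (m ∸ a))     ≈⟨ Σ-cong (suc m) (λ a a<1+m → trans (Σ-*ʳ (suc a) _ _)
                                                       (sym (Σ-extend (suc a) (suc m) _ a<1+m
                                                          (λ k a<k → trans (*-congʳ (oF k a a<k)) (zeroˡ _))))) ⟩
    Σ≤ m (λ a → Σ≤ m (λ k → F k a * g (m ∸ a)))     ≈⟨ Σ-swap (suc m) (suc m) _ ⟩
    Σ≤ m (λ k → Σ≤ m (λ a → F k a * g (m ∸ a)))     ≈⟨ Σ-cong′ (suc m) (λ k → reflexive (≡.sym (⊛-coeff (F k) g m))) ⟩
    Σ∞ (λ k → F k ⊛ g) m                           ∎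

  Σ∞-shift : ∀ F → F 0 ≋ const 0# → (∀ k → HasOrder (suc k) (F (suc k))) → Σ∞ F ≋ Σ∞ (λ k → F (suc k))
  Σ∞-shift F F0≋0 oF = mk λ m → begin
    Σ≤ m (λ k → F k m)                  ≈⟨ Σ-head m (λ k → F k m) ⟩
    F 0 m + Σ< m (λ k → F (suc k) m)    ≈⟨ +-congʳ (trans (at F0≋0 m) (const-0# m)) ⟩
    0# + Σ< m (λ k → F (suc k) m)       ≈⟨ +-identityˡ _ ⟩
    Σ< m (λ k → F (suc k) m)            ≈⟨ +-identityʳ _ ⟨
    Σ< m (λ k → F (suc k) m) + 0#       ≈⟨ +-congˡ (oF m m (ℕP.n<1+n m)) ⟨
    Σ≤ m (λ k → F (suc k) m)            ∎

  Σ∞-single : ∀ F → (∀ k → ¬ (k ≡ 1) → F k ≋ const 0#) → HasOrder 1 (F 1) → Σ∞ F ≋ F 1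
  Σ∞-single F others o1 = mk λ
    { zero    → trans (+-identityˡ _) (trans (at (others 0 (λ ())) 0) (sym (o1 0 (s≤s z≤n))))
    ; (suc m) → Σ-single (suc (suc m)) 1 _ (s≤s (s≤s z≤n))
                  (λ k _ k≢1 → trans (at (others k k≢1) (suc m)) (const-0# (suc m))) }

  const-Σ : ∀ n (f : ℕ → Carrier) → const (Σ< n f) ≋ Ring.Σ< n (λ a → const (f a))
  const-Σ zero    f = ≋-refl
  const-Σ (suc n) f = ≋-trans (const-+ _ _) (⊕-cong (const-Σ n f) ≋-refl)

  Σ-scal-⊛ : ∀ n (c : ℕ → Carrier) (g : ℕ → Series) f m →
    ((λ i → Σ< n (λ j → c j * g j i)) ⊛ f) m ≈ Σ< n (λ j → c j * (g j ⊛ f) m)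
  Σ-scal-⊛ n c g f m = begin
    ((λ i → Σ< n (λ j → c j * g j i)) ⊛ f) m            ≡⟨ ⊛-coeff _ f m ⟩
    Σ≤ m (λ a → Σ< n (λ j → c j * g j a) * f (m ∸ a))   ≈⟨ Σ-cong′ (suc m) (λ a → Σ-*ʳ n (f (m ∸ a)) _) ⟩
    Σ≤ m (λ a → Σ< n (λ j → c j * g j a * f (m ∸ a)))   ≈⟨ Σ-swap (suc m) n _ ⟩
    Σ< n (λ j → Σ≤ m (λ a → c j * g j a * f (m ∸ a)))   ≈⟨ Σ-cong′ n (λ j → trans (Σ-cong′ (suc m) (λ a → *-assoc _ _ _))
                                                           (sym (Σ-*ˡ (suc m) (c j) _))) ⟩
    Σ< n (λ j → c j * Σ≤ m (λ a → g j a * f (m ∸ a)))   ≈⟨ Σ-cong′ n (λ j → *-congˡ (reflexive (≡.sym (⊛-coeff (g j) f m)))) ⟩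
    Σ< n (λ j → c j * (g j ⊛ f) m)                      ∎

module Q = PowerSeries ℚP.+-*-commutativeRing

-- Series in t and y, as series in t whose coefficients are series in y.
module Q² = PowerSeries Q.ring

module RationalLemmas where

  open import Defs using (ℕ→ℚ; recip)
  open import Data.Nat as ℕ using (ℕ; zero; suc; _!)
  open import Data.Integer as ℤ using (+_)
  import Data.Integer.Properties as ℤP
  open import Data.Rational as ℚ using (ℚ; 0ℚ; 1ℚ; _+_; _*_; _-_; ≢-nonZero; mkℚ)
  open import Data.Rational.Solver using (module +-*-Solver)
  import Data.Rational.Unnormalised as ℚᵘ
  import Data.Rational.Unnormalised.Properties as ℚᵘP
  import Data.Nat.Coprimality as Coprime
  open import Data.Nat.Properties using (suc-pred; _!≢0)
  open import Relation.Binary.PropositionalEquality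
  open import Relation.Nullary using (yes; no; ¬_)
  open import Data.Empty using (⊥-elim)

  a-[a-x]≡x : ∀ a x → a - (a - x) ≡ x
  a-[a-x]≡x = solve 2 (λ a x → a :- (a :- x) := x) refl
    where open +-*-Solver

  recip-inverseʳ : ∀ q → ¬ (q ≡ 0ℚ) → q * recip q ≡ 1ℚ
  recip-inverseʳ q q≢0 with q ℚP.≟ 0ℚ
  ... | yes q≡0 = ⊥-elim (q≢0 q≡0)
  ... | no  q≢0 = ℚP.*-inverseʳ q {{≢-nonZero q≢0}}

  recip-inverseˡ : ∀ q → ¬ (q ≡ 0ℚ) → recip q * q ≡ 1ℚ
  recip-inverseˡ q q≢0 = trans (ℚP.*-comm (recip q) q) (recip-inverseʳ q q≢0)

  *≡1⇒≢0 : ∀ x y → x * y ≡ 1ℚ → ¬ (x ≡ 0ℚ)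
  *≡1⇒≢0 x y xy≡1 refl with trans (sym (ℚP.*-zeroˡ y)) xy≡1
  ... | ()

  *-cancelˡ : ∀ q {x y} → ¬ (q ≡ 0ℚ) → q * x ≡ q * y → x ≡ y
  *-cancelˡ q {x} {y} q≢0 qx≡qy = begin
    x                  ≡⟨ sym (ℚP.*-identityˡ x) ⟩
    1ℚ * x             ≡⟨ cong (_* x) (sym (recip-inverseˡ q q≢0)) ⟩
    (recip q * q) * x  ≡⟨ ℚP.*-assoc (recip q) q x ⟩
    recip q * (q * x)  ≡⟨ cong (recip q *_) qx≡qy ⟩
    recip q * (q * y)  ≡⟨ sym (ℚP.*-assoc (recip q) q y) ⟩
    (recip q * q) * y  ≡⟨ cong (_* y) (recip-inverseˡ q q≢0) ⟩
    1ℚ * y             ≡⟨ ℚP.*-identityˡ y ⟩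
    y                  ∎
    where open ≡-Reasoning

  *-recip-cancel : ∀ x y z → ¬ (x ≡ 0ℚ) → (x * y) * (recip x * z) ≡ y * z
  *-recip-cancel x y z x≢0 = begin
    (x * y) * (recip x * z)    ≡⟨ solve 4 (λ x y x′ z → (x :* y) :* (x′ :* z) := (x′ :* x) :* (y :* z)) refl x y (recip x) z ⟩
    (recip x * x) * (y * z)    ≡⟨ cong (_* (y * z)) (recip-inverseˡ x x≢0) ⟩
    1ℚ * (y * z)               ≡⟨ ℚP.*-identityˡ (y * z) ⟩
    y * z                      ∎
    where
    open ≡-Reasoning
    open +-*-Solver

  recip-*-distrib : ∀ p q → ¬ (p ≡ 0ℚ) → ¬ (q ≡ 0ℚ) → recip (p * q) ≡ recip p * recip q
  recip-*-distrib p q p≢0 q≢0 = *-cancelˡ (p * q) pq≢0 (trans (recip-inverseʳ (p * q) pq≢0) (sym pq[p⁻¹q⁻¹]≡1))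
    where
    pq[p⁻¹q⁻¹]≡1 : (p * q) * (recip p * recip q) ≡ 1ℚ
    pq[p⁻¹q⁻¹]≡1 = trans (Q.*-interchange p q (recip p) (recip q))
      (cong₂ _*_ (recip-inverseʳ p p≢0) (recip-inverseʳ q q≢0))
    pq≢0 : ¬ (p * q ≡ 0ℚ)
    pq≢0 = *≡1⇒≢0 (p * q) _ pq[p⁻¹q⁻¹]≡1

  ^-≢0 : ∀ x k → ¬ (x ≡ 0ℚ) → ¬ (x Q.^ k ≡ 0ℚ)
  ^-≢0 x k x≢0 = *≡1⇒≢0 _ (recip x Q.^ k)
    (trans (sym (Q.^-distrib-* x (recip x) k)) (trans (Q.^-congˡ k (recip-inverseʳ x x≢0)) (1^k≡1 k)))
    where
    1^k≡1 : ∀ k → 1ℚ Q.^ k ≡ 1ℚ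
    1^k≡1 zero    = refl
    1^k≡1 (suc k) = trans (ℚP.*-identityˡ (1ℚ Q.^ k)) (1^k≡1 k)

  private
    ℕ→ℚ≡mkℚ : ∀ k → ℕ→ℚ k ≡ mkℚ (+ k) 0 (Coprime.sym (Coprime.1-coprimeTo k))
    ℕ→ℚ≡mkℚ k = ℚP.normalize-coprime (Coprime.sym (Coprime.1-coprimeTo k))

    toℚᵘ-ℕ→ℚ : ∀ k → ℚ.toℚᵘ (ℕ→ℚ k) ≡ ℚᵘ.mkℚᵘ (+ k) 0
    toℚᵘ-ℕ→ℚ k = cong ℚ.toℚᵘ (ℕ→ℚ≡mkℚ k)

  ℕ→ℚ-+ : ∀ a b → ℕ→ℚ (a ℕ.+ b) ≡ ℕ→ℚ a + ℕ→ℚ b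
  ℕ→ℚ-+ a b = ℚP.toℚᵘ-injective (ℚᵘP.≃-trans (ℚᵘP.≃-reflexive (toℚᵘ-ℕ→ℚ (a ℕ.+ b)))
    (ℚᵘP.≃-trans sum (ℚᵘP.≃-sym (ℚᵘP.≃-trans (ℚP.toℚᵘ-homo-+ (ℕ→ℚ a) (ℕ→ℚ b))
      (ℚᵘP.≃-reflexive (cong₂ ℚᵘ._+_ (toℚᵘ-ℕ→ℚ a) (toℚᵘ-ℕ→ℚ b)))))))
    where
    sum : ℚᵘ.mkℚᵘ (+ (a ℕ.+ b)) 0 ℚᵘ.≃ (ℚᵘ.mkℚᵘ (+ a) 0 ℚᵘ.+ ℚᵘ.mkℚᵘ (+ b) 0)
    sum = ℚᵘ.*≡* (cong (ℤ._* + 1) (cong₂ ℤ._+_ (sym (ℤP.*-identityʳ (+ a))) (sym (ℤP.*-identityʳ (+ b)))))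

  ℕ→ℚ-* : ∀ a b → ℕ→ℚ (a ℕ.* b) ≡ ℕ→ℚ a * ℕ→ℚ b
  ℕ→ℚ-* a b = ℚP.toℚᵘ-injective (ℚᵘP.≃-trans (ℚᵘP.≃-reflexive (toℚᵘ-ℕ→ℚ (a ℕ.* b)))
    (ℚᵘP.≃-trans (ℚᵘP.≃-reflexive (cong (λ z → ℚᵘ.mkℚᵘ z 0) (ℤP.pos-* a b)))
      (ℚᵘP.≃-sym (ℚᵘP.≃-trans (ℚP.toℚᵘ-homo-* (ℕ→ℚ a) (ℕ→ℚ b))
        (ℚᵘP.≃-reflexive (cong₂ ℚᵘ._*_ (toℚᵘ-ℕ→ℚ a) (toℚᵘ-ℕ→ℚ b)))))))

  ℕ→ℚ-suc≢0 : ∀ k → ¬ (ℕ→ℚ (suc k) ≡ 0ℚ)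
  ℕ→ℚ-suc≢0 k e with trans (sym (ℕ→ℚ≡mkℚ (suc k))) e
  ... | ()

  ℕ→ℚ-!≢0 : ∀ m → ¬ (ℕ→ℚ (m !) ≡ 0ℚ)
  ℕ→ℚ-!≢0 m e = ℕ→ℚ-suc≢0 (ℕ.pred (m !)) (trans (cong ℕ→ℚ (suc-pred (m !) {{m !≢0}})) e)

module SeriesInT where

  open import Defs
  open RationalLemmas
  open import Data.Nat as ℕ using (ℕ; zero; suc; _∸_; z≤n; s≤s; _!) renaming (_≤_ to _≤ℕ_; _<_ to _<ℕ_)
  import Data.Nat.Properties as ℕP
  open import Data.Rational using (ℚ; 0ℚ; 1ℚ; _+_; _*_; -_; _-_)
  open import Data.Rational.Solver using (module +-*-Solver)
  open import Relation.Binary.PropositionalEquality as ≡ using (_≡_; refl; sym; trans; cong; cong₂)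
  open import Relation.Nullary using (¬_)
  open import Data.Empty using (⊥-elim)
  open Q using (_≋_; mk; at; ≋-refl; ≋-sym; ≋-trans)

  Σ<-agrees : ∀ n f → Σ< n f ≡ Q.Σ< n f
  Σ<-agrees zero    f = refl
  Σ<-agrees (suc n) f = cong (_+ f n) (Σ<-agrees n f)

  ⊛-agrees : ∀ f g → f ⊛ g ≋ f Q.⊛ g
  ⊛-agrees f g = mk λ m → trans (Σ<-agrees (suc m) _) (sym (Q.⊛-coeff f g m))

  const-agrees : ∀ x → const x ≋ Q.const x
  const-agrees x = mk λ { zero → refl ; (suc m) → refl }

  pow-agrees : ∀ f k → pow f k ≋ Q.pow f k
  pow-agrees f zero    = const-agrees 1ℚ
  pow-agrees f (suc k) = ≋-trans (⊛-agrees f (pow f k)) (Q.⊛-cong ≋-refl (pow-agrees f k))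

  ^ℚ-agrees : ∀ q k → q ^ℚ k ≡ q Q.^ k
  ^ℚ-agrees q zero    = refl
  ^ℚ-agrees q (suc k) = cong (q *_) (^ℚ-agrees q k)

  ⊛-coeff-0 : ∀ f g → (f Q.⊛ g) 0 ≡ f 0 * g 0
  ⊛-coeff-0 f g = trans (Q.⊛-coeff f g 0) (ℚP.+-identityˡ (f 0 * g 0))

  pow-coeff-0 : ∀ f k → pow f k 0 ≡ f 0 Q.^ k
  pow-coeff-0 f zero    = refl
  pow-coeff-0 f (suc k) = trans (at (⊛-agrees f (pow f k)) 0) (trans (⊛-coeff-0 f _) (cong (f 0 *_) (pow-coeff-0 f k)))

  inv-inverse : ∀ f → ¬ (f 0 ≡ 0ℚ) → f Q.⊛ inv f ≋ Q.const 1ℚ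
  inv-inverse f f0≢0 = begin
    f Q.⊛ inv f                         ≈⟨ Q.⊛-cong ≋-refl inv≋rG ⟩
    f Q.⊛ Q.scal r (Q.geometric h)      ≈⟨ Q.⊛-scal r f _ ⟩
    Q.scal r (f Q.⊛ Q.geometric h)      ≈⟨ Q.scal-⊛ r f _ ⟩
    Q.scal r f Q.⊛ Q.geometric h        ≈⟨ Q.⊛-cong (mk λ m → a-[a-x]≡x (Q.const 1ℚ m) (r * f m)) ≋-refl ⟨
    (Q.const 1ℚ Q.⊖ h) Q.⊛ Q.geometric h ≈⟨ Q.geometric-inverse h h-HasOrder ⟩
    Q.const 1ℚ                          ∎
    where
    open Q.≋-Reasoning
    r = recip (f 0)
    h = Q.const 1ℚ Q.⊖ Q.scal r f

    inv≋rG : inv f ≋ Q.scal r (Q.geometric h)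
    inv≋rG = mk λ m → cong (r *_) (trans (Σ<-agrees (suc m) _) (Q.Σ-cong′ (suc m)
      (λ k → at (≋-trans (pow-agrees _ k) (Q.pow-cong k (Q.⊖-cong (const-agrees 1ℚ) ≋-refl))) m)))

    h-HasOrder : Q.HasOrder 1 h
    h-HasOrder zero    _         = cong (λ z → 1ℚ - z) (recip-inverseˡ (f 0) f0≢0)
    h-HasOrder (suc i) (s≤s ())

  deriv : Q.Series → Q.Series
  deriv f m = ℕ→ℚ (suc m) * f (suc m)

  -- (m+1) = i + (m+1-i) splits each term of the Cauchy product.
  deriv-⊛ : ∀ f g → deriv (f Q.⊛ g) ≋ deriv f Q.⊛ g Q.⊕ f Q.⊛ deriv g
  deriv-⊛ f g = mk λ m → begin
    ℕ→ℚ (suc m) * (f Q.⊛ g) (suc m)                                    ≡⟨ cong (ℕ→ℚ (suc m) *_) (Q.⊛-coeff f g (suc m)) ⟩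
    ℕ→ℚ (suc m) * Q.Σ≤ (suc m) (λ i → f i * g (suc m ∸ i))             ≡⟨ Q.Σ-*ˡ (suc (suc m)) (ℕ→ℚ (suc m)) _ ⟩
    Q.Σ≤ (suc m) (λ i → ℕ→ℚ (suc m) * (f i * g (suc m ∸ i)))           ≡⟨ Q.Σ-cong (suc (suc m)) (λ i i≤1+m → split m i (ℕP.≤-pred i≤1+m)) ⟩
    Q.Σ≤ (suc m) (λ i → A m i + B m i)                                 ≡⟨ Q.Σ-+ (suc (suc m)) _ _ ⟩
    Q.Σ≤ (suc m) (A m) + Q.Σ≤ (suc m) (B m)                            ≡⟨ cong₂ _+_ (ΣA m) (ΣB m) ⟩
    (deriv f Q.⊛ g) m + (f Q.⊛ deriv g) m                              ∎
    where
    open ≡.≡-Reasoning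
    A B : ℕ → ℕ → ℚ
    A m i = ℕ→ℚ i * (f i * g (suc m ∸ i))
    B m i = ℕ→ℚ (suc m ∸ i) * (f i * g (suc m ∸ i))

    split : ∀ m i → i ≤ℕ suc m → ℕ→ℚ (suc m) * (f i * g (suc m ∸ i)) ≡ A m i + B m i
    split m i i≤1+m = trans (cong (λ z → ℕ→ℚ z * (f i * g (suc m ∸ i))) (sym (ℕP.m+[n∸m]≡n i≤1+m)))
      (trans (cong (_* (f i * g (suc m ∸ i))) (ℕ→ℚ-+ i (suc m ∸ i))) (ℚP.*-distribʳ-+ _ (ℕ→ℚ i) _))

    ΣA : ∀ m → Q.Σ≤ (suc m) (A m) ≡ (deriv f Q.⊛ g) m
    ΣA m = trans (Q.Σ-head (suc m) (A m)) (trans (cong (_+ Q.Σ≤ m (λ i → A m (suc i))) (ℚP.*-zeroˡ (f 0 * g (suc m))))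
      (trans (ℚP.+-identityˡ _) (trans (Q.Σ-cong′ (suc m) (λ i → sym (ℚP.*-assoc (ℕ→ℚ (suc i)) (f (suc i)) _)))
        (sym (Q.⊛-coeff _ _ m)))))

    ΣB : ∀ m → Q.Σ≤ (suc m) (B m) ≡ (f Q.⊛ deriv g) m
    ΣB m = trans (cong (Q.Σ≤ m (B m) +_) (trans (cong (λ z → ℕ→ℚ z * (f (suc m) * g z)) (ℕP.n∸n≡0 m)) (ℚP.*-zeroˡ (f (suc m) * g 0))))
      (trans (ℚP.+-identityʳ _) (trans (Q.Σ-cong (suc m) (λ i i<1+m → trans
        (cong (λ z → ℕ→ℚ z * (f i * g z)) (ℕP.+-∸-assoc 1 (ℕP.≤-pred i<1+m))) (Q.x∙yz≈y∙xz (ℕ→ℚ (suc (m ∸ i))) (f i) _)))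
        (sym (Q.⊛-coeff _ _ m))))

  deriv-unique : ∀ c u v → u 0 ≡ v 0 → deriv u ≋ Q.scal c u → deriv v ≋ Q.scal c v → u ≋ v
  deriv-unique c u v u0≡v0 u′≋cu v′≋cv = mk u≗v
    where
    u≗v : ∀ m → u m ≡ v m
    u≗v zero    = u0≡v0
    u≗v (suc m) = *-cancelˡ (ℕ→ℚ (suc m)) (ℕ→ℚ-suc≢0 m)
      (trans (at u′≋cu m) (trans (cong (c *_) (u≗v m)) (sym (at v′≋cv m))))

  deriv-expS : ∀ a → deriv (expS a) ≋ Q.scal a (expS a)
  deriv-expS a = mk λ m → begin
    ℕ→ℚ (suc m) * ((a * (a ^ℚ m)) * recip (ℕ→ℚ (suc m ℕ.* m !)))
      ≡⟨ cong (λ z → ℕ→ℚ (suc m) * ((a * (a ^ℚ m)) * z))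
           (trans (cong recip (ℕ→ℚ-* (suc m) (m !))) (recip-*-distrib _ _ (ℕ→ℚ-suc≢0 m) (ℕ→ℚ-!≢0 m))) ⟩
    ℕ→ℚ (suc m) * ((a * (a ^ℚ m)) * (recip (ℕ→ℚ (suc m)) * recip (ℕ→ℚ (m !))))
      ≡⟨ solve 5 (λ n a b r s → n :* ((a :* b) :* (r :* s)) := (r :* n) :* (a :* (b :* s))) refl
           (ℕ→ℚ (suc m)) a (a ^ℚ m) (recip (ℕ→ℚ (suc m))) (recip (ℕ→ℚ (m !))) ⟩
    (recip (ℕ→ℚ (suc m)) * ℕ→ℚ (suc m)) * (a * ((a ^ℚ m) * recip (ℕ→ℚ (m !))))
      ≡⟨ cong (_* (a * ((a ^ℚ m) * recip (ℕ→ℚ (m !))))) (recip-inverseˡ (ℕ→ℚ (suc m)) (ℕ→ℚ-suc≢0 m)) ⟩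
    1ℚ * (a * ((a ^ℚ m) * recip (ℕ→ℚ (m !))))
      ≡⟨ ℚP.*-identityˡ _ ⟩
    a * ((a ^ℚ m) * recip (ℕ→ℚ (m !)))  ∎
    where
    open ≡.≡-Reasoning
    open +-*-Solver

  expS-+ : ∀ a b → expS a Q.⊛ expS b ≋ expS (a + b)
  expS-+ a b = deriv-unique (a + b) _ _ (⊛-coeff-0 (expS a) (expS b)) deriv-eaeb (deriv-expS (a + b))
    where
    open Q.≋-Reasoning
    deriv-eaeb : deriv (expS a Q.⊛ expS b) ≋ Q.scal (a + b) (expS a Q.⊛ expS b)
    deriv-eaeb = begin
      deriv (expS a Q.⊛ expS b)                                             ≈⟨ deriv-⊛ _ _ ⟩
      deriv (expS a) Q.⊛ expS b Q.⊕ expS a Q.⊛ deriv (expS b)               ≈⟨ Q.⊕-cong (Q.⊛-cong (deriv-expS a) ≋-refl)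
                                                                                         (Q.⊛-cong ≋-refl (deriv-expS b)) ⟩
      Q.scal a (expS a) Q.⊛ expS b Q.⊕ expS a Q.⊛ Q.scal b (expS b)         ≈⟨ Q.⊕-cong (≋-sym (Q.scal-⊛ a _ _)) (Q.⊛-scal b _ _) ⟩
      Q.scal a (expS a Q.⊛ expS b) Q.⊕ Q.scal b (expS a Q.⊛ expS b)         ≈⟨ mk (λ m → sym (ℚP.*-distribʳ-+ _ a b)) ⟩
      Q.scal (a + b) (expS a Q.⊛ expS b)                                    ∎

  expS-0 : expS 0ℚ ≋ Q.const 1ℚ
  expS-0 = mk λ { zero → refl ; (suc m) → trans (cong (_* recip (ℕ→ℚ (suc m !))) (ℚP.*-zeroˡ (0ℚ ^ℚ m))) (ℚP.*-zeroˡ (recip (ℕ→ℚ (suc m !)))) }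

  𝕥 : Q.Series
  𝕥 (suc zero) = 1ℚ
  𝕥 _          = 0ℚ

  𝕥⊛-coeff-suc : ∀ g m → (𝕥 Q.⊛ g) (suc m) ≡ g m
  𝕥⊛-coeff-suc g m = trans (Q.⊛-coeff _ _ (suc m)) (trans (Q.Σ-single (suc (suc m)) 1 _ (s≤s (s≤s z≤n)) others)
    (ℚP.*-identityˡ (g m)))
    where
    others : ∀ i → i <ℕ suc (suc m) → ¬ (i ≡ 1) → 𝕥 i * g (suc m ∸ i) ≡ 0ℚ
    others zero          _ _   = ℚP.*-zeroˡ (g (suc m))
    others (suc zero)    _ i≢1 = ⊥-elim (i≢1 refl)
    others (suc (suc i)) _ _   = ℚP.*-zeroˡ (g (m ∸ suc i))

  𝕥⊛divT : ∀ f → f 0 ≡ 0ℚ → 𝕥 Q.⊛ divT f ≋ f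
  𝕥⊛divT f f0≡0 = mk λ
    { zero    → trans (⊛-coeff-0 𝕥 _) (trans (ℚP.*-zeroˡ (divT f 0)) (sym f0≡0))
    ; (suc m) → 𝕥⊛-coeff-suc _ m }

  𝕥⊛-cancel : ∀ u v → 𝕥 Q.⊛ u ≋ 𝕥 Q.⊛ v → u ≋ v
  𝕥⊛-cancel u v e = mk λ m → trans (sym (𝕥⊛-coeff-suc u m)) (trans (at e (suc m)) (𝕥⊛-coeff-suc v m))

  ½ : ℚ
  ½ = recip (ℕ→ℚ 2)

  eᵗ+1 : Q.Series
  eᵗ+1 = eT Q.⊕ Q.const 1ℚ

  eT+1-agrees : eT+1 ≋ eᵗ+1
  eT+1-agrees = Q.⊕-cong (≋-refl {eT}) (const-agrees 1ℚ)

  X : Q.Series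
  X = (eT Q.⊖ Q.const 1ℚ) Q.⊛ inv eT+1

  tanhHalf-agrees : tanhHalf ≋ X
  tanhHalf-agrees = ≋-trans (⊛-agrees _ _) (Q.⊛-cong (Q.⊖-cong (≋-refl {eT}) (const-agrees 1ℚ)) (≋-refl {inv eT+1}))

  X-HasOrder : Q.HasOrder 1 X
  X-HasOrder zero    _         = trans (⊛-coeff-0 (eT Q.⊖ Q.const 1ℚ) (inv eT+1)) (ℚP.*-zeroˡ (inv eT+1 0))
  X-HasOrder (suc i) (s≤s ())

  inv-eT+1 : eᵗ+1 Q.⊛ inv eT+1 ≋ Q.const 1ℚ
  inv-eT+1 = ≋-trans (Q.⊛-cong (≋-sym eT+1-agrees) ≋-refl) (inv-inverse eT+1 λ ())

  X⊛eᵗ+1 : X Q.⊛ eᵗ+1 ≋ eT Q.⊖ Q.const 1ℚ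
  X⊛eᵗ+1 = ≋-trans (Q.⊛-assoc _ _ _) (≋-trans (Q.⊛-cong ≋-refl (≋-trans (Q.⊛-comm _ _) inv-eT+1)) (Q.⊛-identityʳ _))

  eT+1^1-n⊛pow : ∀ n → eT+1^1-n n Q.⊛ Q.pow eᵗ+1 (suc n) ≋ eᵗ+1 Q.⊛ eᵗ+1
  eT+1^1-n⊛pow zero    = Q.⊛-cong eT+1-agrees (Q.⊛-identityʳ eᵗ+1)
  eT+1^1-n⊛pow (suc k) = begin
    inv (pow eT+1 k) Q.⊛ Q.pow eᵗ+1 (2 ℕ.+ k)                    ≈⟨ Q.⊛-cong ≋-refl (≋-trans (Q.pow-+ eᵗ+1 2 k) (Q.⊛-comm _ _)) ⟩
    inv (pow eT+1 k) Q.⊛ (Q.pow eᵗ+1 k Q.⊛ Q.pow eᵗ+1 2)         ≈⟨ Q.⊛-assoc _ _ _ ⟨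
    (inv (pow eT+1 k) Q.⊛ Q.pow eᵗ+1 k) Q.⊛ Q.pow eᵗ+1 2         ≈⟨ Q.⊛-cong inv⊛pow ≋-refl ⟩
    Q.const 1ℚ Q.⊛ Q.pow eᵗ+1 2                                 ≈⟨ Q.⊛-identityˡ _ ⟩
    eᵗ+1 Q.⊛ (eᵗ+1 Q.⊛ Q.const 1ℚ)                              ≈⟨ Q.⊛-cong ≋-refl (Q.⊛-identityʳ _) ⟩
    eᵗ+1 Q.⊛ eᵗ+1                                               ∎
    where
    open Q.≋-Reasoning
    powᵏ≢0 : ¬ (pow eT+1 k 0 ≡ 0ℚ)
    powᵏ≢0 e = ^-≢0 (eT+1 0) k (λ ()) (trans (sym (pow-coeff-0 eT+1 k)) e)
    inv⊛pow : inv (pow eT+1 k) Q.⊛ Q.pow eᵗ+1 k ≋ Q.const 1ℚ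
    inv⊛pow = ≋-trans (Q.⊛-comm _ _) (≋-trans (Q.⊛-cong (≋-sym (≋-trans (pow-agrees eT+1 k) (Q.pow-cong k eT+1-agrees))) ≋-refl)
      (inv-inverse (pow eT+1 k) powᵏ≢0))

  -- e^t sinh t = (e^{2t} - 1)/2 = (e^t + 1)(e^t - 1)/2
  eᵗ⊛sinh : eT Q.⊛ sinhS ≋ Q.scal ½ ((eᵗ+1 Q.⊛ eᵗ+1) Q.⊛ X)
  eᵗ⊛sinh = begin
    eT Q.⊛ Q.scal ½ (eT Q.⊖ expS (- 1ℚ))                     ≈⟨ Q.⊛-scal ½ eT _ ⟩
    Q.scal ½ (eT Q.⊛ (eT Q.⊖ expS (- 1ℚ)))                   ≈⟨ Q.scal-cong ½ (Q.Ring.x[y-z]≈xy-xz eT eT _) ⟩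
    Q.scal ½ (eT Q.⊛ eT Q.⊖ eT Q.⊛ expS (- 1ℚ))              ≈⟨ Q.scal-cong ½ (Q.⊖-cong (≋-refl {eT Q.⊛ eT})
                                                                 (≋-trans (expS-+ 1ℚ (- 1ℚ)) (≋-trans expS-0 (≋-sym (Q.⊛-identityˡ _))))) ⟩
    Q.scal ½ (eT Q.⊛ eT Q.⊖ Q.const 1ℚ Q.⊛ Q.const 1ℚ)      ≈⟨ Q.scal-cong ½ (Q.Ring.difference-of-squares eT (Q.const 1ℚ)) ⟨
    Q.scal ½ (eᵗ+1 Q.⊛ (eT Q.⊖ Q.const 1ℚ))                  ≈⟨ Q.scal-cong ½ (Q.⊛-cong ≋-refl (≋-sym X⊛eᵗ+1)) ⟩
    Q.scal ½ (eᵗ+1 Q.⊛ (X Q.⊛ eᵗ+1))                         ≈⟨ Q.scal-cong ½ (≋-trans (Q.⊛-cong ≋-refl (Q.⊛-comm _ _))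
                                                                 (≋-sym (Q.⊛-assoc _ _ _))) ⟩
    Q.scal ½ ((eᵗ+1 Q.⊛ eᵗ+1) Q.⊛ X)                         ∎
    where open Q.≋-Reasoning

module RisingFactorials where

  open import Defs
  open RationalLemmas
  open SeriesInT using (Σ<-agrees)
  open import Data.Nat as ℕ using (ℕ; zero; suc; z≤n; s≤s) renaming (_≤_ to _≤ℕ_)
  import Data.Nat.Properties as ℕP
  import Data.Nat.Solver as ℕSolver
  open import Data.List using ([]; _∷_; length)
  open import Data.Rational using (ℚ; 0ℚ; _+_; _*_)
  open import Data.Rational.Solver using (module +-*-Solver)
  open import Relation.Binary.PropositionalEquality as ≡ using (_≡_; refl; sym; trans; cong; cong₂)

  risingFactorial : ℕ → ℕ → ℕ
  risingFactorial k zero    = 1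
  risingFactorial k (suc n) = k ℕ.* risingFactorial (suc k) n

  risingFactorial-suc : ∀ k n → risingFactorial k (suc n) ≡ risingFactorial k n ℕ.* (k ℕ.+ n)
  risingFactorial-suc k zero    = solve 1 (λ k → k :* con 1 := con 1 :* (k :+ con 0)) refl k
    where open ℕSolver.+-*-Solver
  risingFactorial-suc k (suc n) = trans (cong (k ℕ.*_) (risingFactorial-suc (suc k) n))
    (solve 3 (λ k r n → k :* (r :* (con 1 :+ k :+ n)) := k :* r :* (k :+ (con 1 :+ n))) refl k (risingFactorial (suc k) n) n)
    where open ℕSolver.+-*-Solver

  risingFactorial-Δ : ∀ k n →
    risingFactorial (suc k) (suc n) ≡ risingFactorial k (suc n) ℕ.+ suc n ℕ.* risingFactorial (suc k) n
  risingFactorial-Δ k n = trans (risingFactorial-suc (suc k) n)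
    (solve 3 (λ k n r → r :* (con 1 :+ k :+ n) := k :* r :+ (con 1 :+ n) :* r) refl k n (risingFactorial (suc k) n))
    where open ℕSolver.+-*-Solver

  eval : Poly → ℚ → ℚ
  eval []      x = 0ℚ
  eval (a ∷ p) x = ℕ→ℚ a + x * eval p x

  eval-padd : ∀ p q x → eval (padd p q) x ≡ eval p x + eval q x
  eval-padd []      q       x = sym (ℚP.+-identityˡ (eval q x))
  eval-padd (a ∷ p) []      x = sym (ℚP.+-identityʳ _)
  eval-padd (a ∷ p) (b ∷ q) x = trans (cong₂ (λ u v → u + x * v) (ℕ→ℚ-+ a b) (eval-padd p q x))
    (solve 5 (λ A B X E F → (A :+ B) :+ X :* (E :+ F) := (A :+ X :* E) :+ (B :+ X :* F)) refl
      (ℕ→ℚ a) (ℕ→ℚ b) x (eval p x) (eval q x))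
    where open +-*-Solver

  eval-pscale : ∀ c p x → eval (pscale c p) x ≡ ℕ→ℚ c * eval p x
  eval-pscale c []      x = sym (ℚP.*-zeroʳ (ℕ→ℚ c))
  eval-pscale c (a ∷ p) x = trans (cong₂ (λ u v → u + x * v) (ℕ→ℚ-* c a) (eval-pscale c p x))
    (solve 4 (λ C A X E → C :* A :+ X :* (C :* E) := C :* (A :+ X :* E)) refl (ℕ→ℚ c) (ℕ→ℚ a) x (eval p x))
    where open +-*-Solver

  eval-mulLin : ∀ c p x → eval (mulLin c p) x ≡ eval p x * (x + ℕ→ℚ c)
  eval-mulLin c p x = trans (eval-padd (pscale c p) (0 ∷ p) x) (trans (cong (_+ eval (0 ∷ p) x) (eval-pscale c p x))
    (solve 3 (λ C E X → C :* E :+ (con 0ℚ :+ X :* E) := E :* (X :+ C)) refl (ℕ→ℚ c) (eval p x) x))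
    where open +-*-Solver

  eval-rising : ∀ k n → eval (rising n) (ℕ→ℚ k) ≡ ℕ→ℚ (risingFactorial k n)
  eval-rising k zero    = trans (cong (ℕ→ℚ 1 +_) (ℚP.*-zeroʳ (ℕ→ℚ k))) (ℚP.+-identityʳ (ℕ→ℚ 1))
  eval-rising k (suc n) = begin
    eval (mulLin n (rising n)) (ℕ→ℚ k)                ≡⟨ eval-mulLin n (rising n) (ℕ→ℚ k) ⟩
    eval (rising n) (ℕ→ℚ k) * (ℕ→ℚ k + ℕ→ℚ n)         ≡⟨ cong₂ _*_ (eval-rising k n) (sym (ℕ→ℚ-+ k n)) ⟩
    ℕ→ℚ (risingFactorial k n) * ℕ→ℚ (k ℕ.+ n)         ≡⟨ sym (ℕ→ℚ-* (risingFactorial k n) (k ℕ.+ n)) ⟩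
    ℕ→ℚ (risingFactorial k n ℕ.* (k ℕ.+ n))           ≡⟨ cong ℕ→ℚ (sym (risingFactorial-suc k n)) ⟩
    ℕ→ℚ (risingFactorial k (suc n))                   ∎
    where open ≡.≡-Reasoning

  length-padd : ∀ N p q → length p ≤ℕ N → length q ≤ℕ N → length (padd p q) ≤ℕ N
  length-padd N       []      q       _         lq        = lq
  length-padd N       (a ∷ p) []      lp        _         = lp
  length-padd (suc N) (a ∷ p) (b ∷ q) (s≤s lp) (s≤s lq) = s≤s (length-padd N p q lp lq)

  length-pscale : ∀ c p → length (pscale c p) ≡ length p
  length-pscale c []      = refl
  length-pscale c (a ∷ p) = cong suc (length-pscale c p)

  length-rising : ∀ n → length (rising n) ≤ℕ suc n
  length-rising zero    = s≤s z≤n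
  length-rising (suc n) = length-padd (suc (suc n)) (pscale n (rising n)) (0 ∷ rising n)
    (≡.subst (_≤ℕ suc (suc n)) (sym (length-pscale n (rising n))) (ℕP.m≤n⇒m≤1+n (length-rising n)))
    (s≤s (length-rising n))

  Σ-coeff-eval : ∀ p N x → length p ≤ℕ N → Σ< N (λ j → ℕ→ℚ (coeff p j) * (x ^ℚ j)) ≡ eval p x
  Σ-coeff-eval []      N       x _       = trans (Σ<-agrees N _) (Q.Σ-zero N (λ j _ → ℚP.*-zeroˡ (x ^ℚ j)))
  Σ-coeff-eval (a ∷ p) (suc N) x (s≤s l) = trans (Σ<-agrees (suc N) _) (trans (Q.Σ-head N _)
    (cong₂ _+_ (ℚP.*-identityʳ (ℕ→ℚ a)) (trans (Q.Σ-cong′ N (λ j → Q.x∙yz≈y∙xz (ℕ→ℚ (coeff p j)) x (x ^ℚ j)))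
      (trans (sym (Q.Σ-*ˡ N x _)) (cong (x *_) (trans (sym (Σ<-agrees N _)) (Σ-coeff-eval p N x l)))))))

  Σ-stirling1-^ : ∀ n k → Σ≤ n (λ j → ℕ→ℚ (stirling1 n j) * (ℕ→ℚ k ^ℚ j)) ≡ ℕ→ℚ (risingFactorial k n)
  Σ-stirling1-^ n k = trans (Σ-coeff-eval (rising n) (suc n) (ℕ→ℚ k) (length-rising n)) (eval-rising k n)

module SeriesInTY where

  open import Defs
  open RationalLemmas
  open SeriesInT
  open RisingFactorials using (risingFactorial; risingFactorial-Δ)
  open import Data.Nat as ℕ using (ℕ; zero; suc; _∸_; s≤s; _!) renaming (_≤_ to _≤ℕ_; _<_ to _<ℕ_)
  import Data.Nat.Properties as ℕP
  import Data.Nat.Solver as ℕSolver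
  open import Data.Rational using (ℚ; 0ℚ; 1ℚ; _+_; _*_; -_; _-_)
  open import Data.Rational.Solver using (module +-*-Solver)
  open import Relation.Binary.PropositionalEquality as ≡ using (_≡_; refl; sym; trans; cong; cong₂; cong-app)
  open import Relation.Nullary using (¬_; yes; no)
  open import Data.Empty using (⊥-elim)
  open import Data.Vec using ([]; _∷_)
  open import Data.Fin using (#_)
  open import Algebra.Bundles using (CommutativeRing)
  import Algebra.Solver.CommutativeMonoid
  open Q using (_≋_; mk; at; ≋-refl; ≋-sym; ≋-trans)
  open Q² using () renaming (_≋_ to _≋₂_)

  mk₂ : ∀ {f g : Q².Series} → (∀ i j → f i j ≡ g i j) → f ≋₂ g
  mk₂ e = Q².mk λ i → mk λ j → e i j

  at₂ : ∀ {f g : Q².Series} → f ≋₂ g → ∀ i j → f i j ≡ g i j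
  at₂ e i j = at (Q².at e i) j

  Σ-coeff² : ∀ n (F : ℕ → Q.Series) j → Q².Σ< n F j ≡ Q.Σ< n (λ a → F a j)
  Σ-coeff² zero    F zero    = refl
  Σ-coeff² zero    F (suc j) = refl
  Σ-coeff² (suc n) F j       = cong (_+ F n j) (Σ-coeff² n F j)

  ⊛₂-agrees-at : ∀ f g i j → (f ⊛₂ g) i j ≡ (f Q².⊛ g) i j
  ⊛₂-agrees-at f g i j = sym (begin
    (f Q².⊛ g) i j                                          ≡⟨ cong-app (Q².⊛-coeff f g i) j ⟩
    Q².Σ≤ i (λ a → f a Q.⊛ g (i ∸ a)) j                    ≡⟨ Σ-coeff² (suc i) _ j ⟩
    Q.Σ≤ i (λ a → (f a Q.⊛ g (i ∸ a)) j)                   ≡⟨ Q.Σ-cong′ (suc i) (λ a → sym (at (⊛-agrees _ _) j)) ⟩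
    Q.Σ≤ i (λ a → Σ≤ j (λ b → f a b * g (i ∸ a) (j ∸ b)))   ≡⟨ sym (Σ<-agrees (suc i) _) ⟩
    (f ⊛₂ g) i j                                            ∎)
    where open ≡.≡-Reasoning

  ⊛₂-agrees : ∀ f g → f ⊛₂ g ≋₂ f Q².⊛ g
  ⊛₂-agrees f g = mk₂ (⊛₂-agrees-at f g)

  const2-agrees : ∀ c → const2 c ≋₂ Q².const (Q.const c)
  const2-agrees c = mk₂ λ { zero zero → refl ; zero (suc j) → refl ; (suc i) zero → refl ; (suc i) (suc j) → refl }

  pow2-agrees : ∀ f k → pow2 f k ≋₂ Q².pow f k
  pow2-agrees f zero    = const2-agrees 1ℚ
  pow2-agrees f (suc k) = Q².≋-trans (⊛₂-agrees f (pow2 f k)) (Q².⊛-cong Q².≋-refl (pow2-agrees f k))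

  scal2-agrees : ∀ c f → scal2 c f ≋₂ Q².scal (Q.const c) f
  scal2-agrees c f = Q².mk λ i → ≋-sym (Q.const-⊛ c (f i))

  ⊛-local² : ∀ i j {f f′ g g′ : Q².Series} → (∀ a b → a ≤ℕ i → b ≤ℕ j → f a b ≡ f′ a b) →
    (∀ a b → a ≤ℕ i → b ≤ℕ j → g a b ≡ g′ a b) → (f Q².⊛ g) i j ≡ (f′ Q².⊛ g′) i j
  ⊛-local² i j {f} {f′} {g} {g′} ef eg = begin
    (f Q².⊛ g) i j                                             ≡⟨ sym (⊛₂-agrees-at f g i j) ⟩
    Σ≤ i (λ a → Σ≤ j (λ b → f a b * g (i ∸ a) (j ∸ b)))         ≡⟨ Σ<-agrees (suc i) _ ⟩
    Q.Σ≤ i (λ a → Σ≤ j (λ b → f a b * g (i ∸ a) (j ∸ b)))       ≡⟨ Q.Σ-cong (suc i) (λ a a<1+i → inner a (ℕP.≤-pred a<1+i)) ⟩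
    Q.Σ≤ i (λ a → Σ≤ j (λ b → f′ a b * g′ (i ∸ a) (j ∸ b)))     ≡⟨ sym (Σ<-agrees (suc i) _) ⟩
    Σ≤ i (λ a → Σ≤ j (λ b → f′ a b * g′ (i ∸ a) (j ∸ b)))       ≡⟨ ⊛₂-agrees-at f′ g′ i j ⟩
    (f′ Q².⊛ g′) i j                                           ∎
    where
    open ≡.≡-Reasoning
    inner : ∀ a → a ≤ℕ i → Σ≤ j (λ b → f a b * g (i ∸ a) (j ∸ b)) ≡ Σ≤ j (λ b → f′ a b * g′ (i ∸ a) (j ∸ b))
    inner a a≤i = trans (Σ<-agrees (suc j) _) (trans (Q.Σ-cong (suc j) (λ b b<1+j →
      cong₂ _*_ (ef a b a≤i (ℕP.≤-pred b<1+j)) (eg (i ∸ a) (j ∸ b) (ℕP.m∸n≤m i a) (ℕP.m∸n≤m j b))))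
      (sym (Σ<-agrees (suc j) _)))

  HasTotalOrder : ℕ → Q².Series → Set
  HasTotalOrder p f = ∀ i j → i ℕ.+ j <ℕ p → f i j ≡ 0ℚ

  ⊛-HasTotalOrder : ∀ p q f g → HasTotalOrder p f → HasTotalOrder q g → HasTotalOrder (p ℕ.+ q) (f Q².⊛ g)
  ⊛-HasTotalOrder p q f g tf tg i j i+j<p+q = trans (sym (⊛₂-agrees-at f g i j))
    (trans (Σ<-agrees (suc i) _) (Q.Σ-zero (suc i) (λ a a<1+i →
      trans (Σ<-agrees (suc j) _) (Q.Σ-zero (suc j) (λ b b<1+j → term a b (ℕP.≤-pred a<1+i) (ℕP.≤-pred b<1+j))))))
    where
    complement<q : ∀ a b → a ≤ℕ i → b ≤ℕ j → ¬ (a ℕ.+ b <ℕ p) → (i ∸ a) ℕ.+ (j ∸ b) <ℕ q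
    complement<q a b a≤i b≤j a+b≮p = ℕP.+-cancelˡ-< (a ℕ.+ b) _ _
      (ℕP.≤-<-trans (ℕP.≤-reflexive regroup) (ℕP.<-≤-trans i+j<p+q (ℕP.+-monoˡ-≤ q (ℕP.≮⇒≥ a+b≮p))))
      where
      open ℕSolver.+-*-Solver
      regroup : a ℕ.+ b ℕ.+ ((i ∸ a) ℕ.+ (j ∸ b)) ≡ i ℕ.+ j
      regroup = trans (solve 4 (λ a b x y → a :+ b :+ (x :+ y) := (a :+ x) :+ (b :+ y)) refl a b (i ∸ a) (j ∸ b))
        (cong₂ ℕ._+_ (ℕP.m+[n∸m]≡n a≤i) (ℕP.m+[n∸m]≡n b≤j))

    term : ∀ a b → a ≤ℕ i → b ≤ℕ j → f a b * g (i ∸ a) (j ∸ b) ≡ 0ℚ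
    term a b a≤i b≤j with a ℕ.+ b ℕP.<? p
    ... | yes a+b<p = trans (cong (_* g (i ∸ a) (j ∸ b)) (tf a b a+b<p)) (ℚP.*-zeroˡ (g (i ∸ a) (j ∸ b)))
    ... | no  a+b≮p = trans (cong (f a b *_) (tg _ _ (complement<q a b a≤i b≤j a+b≮p))) (ℚP.*-zeroʳ (f a b))

  pow-HasTotalOrder : ∀ h → HasTotalOrder 1 h → ∀ k → HasTotalOrder k (Q².pow h k)
  pow-HasTotalOrder h t zero    i j ()
  pow-HasTotalOrder h t (suc k) = ⊛-HasTotalOrder 1 k h (Q².pow h k) t (pow-HasTotalOrder h t k)

  𝟙 : Q².Series
  𝟙 = Q².const (Q.const 1ℚ)

  -- As for inv: the coefficient of t^i y^j only sees the powers h^k with k ≤ i + j.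
  inv2-inverse : ∀ g → ¬ (g 0 0 ≡ 0ℚ) → g Q².⊛ inv2 g ≋₂ 𝟙
  inv2-inverse g g00≢0 = g⊛inv2≋1
    where
    r = Q.const (recip (g 0 0))
    h = const2 1ℚ ⊖₂ scal2 (recip (g 0 0)) g

    G : Q².Series
    G i j = Q.Σ≤ (i ℕ.+ j) (λ k → Q².pow h k i j)

    inv2≋rG : inv2 g ≋₂ Q².scal r G
    inv2≋rG = mk₂ λ i j → trans (cong (recip (g 0 0) *_) (trans (Σ<-agrees (suc (i ℕ.+ j)) _)
      (Q.Σ-cong′ (suc (i ℕ.+ j)) (λ k → at₂ (pow2-agrees h k) i j)))) (sym (at (Q.const-⊛ _ (G i)) j))

    rg≋1-h : Q².scal r g ≋₂ 𝟙 Q².⊖ h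
    rg≋1-h = mk₂ λ i j → trans (at (Q.const-⊛ _ (g i)) j) (trans (sym (a-[a-x]≡x (𝟙 i j) _))
      (cong (λ z → 𝟙 i j - (z - recip (g 0 0) * g i j)) (sym (at₂ (const2-agrees 1ℚ) i j))))

    h-HasTotalOrder : HasTotalOrder 1 h
    h-HasTotalOrder zero    zero    _ = cong (λ z → 1ℚ - z) (recip-inverseˡ (g 0 0) g00≢0)
    h-HasTotalOrder zero    (suc j) (s≤s ())
    h-HasTotalOrder (suc i) j       (s≤s ())

    telescope : ∀ i j → ((𝟙 Q².⊖ h) Q².⊛ G) i j ≡ 𝟙 i j
    telescope i j = begin
      ((𝟙 Q².⊖ h) Q².⊛ G) i j               ≡⟨ ⊛-local² i j (λ _ _ _ _ → refl) truncation ⟩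
      ((𝟙 Q².⊖ h) Q².⊛ Gᴷ) i j              ≡⟨ at₂ (Q².Ring.geometric-telescope h K) i j ⟩
      𝟙 i j - (h Q².Ring.^ K) i j           ≡⟨ cong (λ z → 𝟙 i j - z) (trans (at₂ (Q².^≋pow h K) i j)
                                                 (pow-HasTotalOrder h h-HasTotalOrder K i j (ℕP.n<1+n _))) ⟩
      𝟙 i j - 0ℚ                            ≡⟨ ℚP.+-identityʳ (𝟙 i j) ⟩
      𝟙 i j                                 ∎
      where
      open ≡.≡-Reasoning
      K = suc (i ℕ.+ j)
      Gᴷ = Q².Ring.Σ< K (h Q².Ring.^_)
      truncation : ∀ a b → a ≤ℕ i → b ≤ℕ j → G a b ≡ Gᴷ a b
      truncation a b a≤i b≤j = sym (trans (at (Q².Σ-coeff K _ a) b) (trans (Σ-coeff² K _ b)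
        (trans (Q.Σ-cong′ K (λ k → at₂ (Q².^≋pow h k) a b))
          (Q.Σ-extend (suc (a ℕ.+ b)) K _ (s≤s (ℕP.+-mono-≤ a≤i b≤j)) (λ k → pow-HasTotalOrder h h-HasTotalOrder k a b)))))

    g⊛inv2≋1 : g Q².⊛ inv2 g ≋₂ 𝟙
    g⊛inv2≋1 = begin
      g Q².⊛ inv2 g            ≈⟨ Q².⊛-cong Q².≋-refl inv2≋rG ⟩
      g Q².⊛ Q².scal r G       ≈⟨ Q².⊛-scal r g G ⟩
      Q².scal r (g Q².⊛ G)     ≈⟨ Q².scal-⊛ r g G ⟩
      Q².scal r g Q².⊛ G       ≈⟨ Q².⊛-cong rg≋1-h Q².≋-refl ⟩
      (𝟙 Q².⊖ h) Q².⊛ G        ≈⟨ mk₂ telescope ⟩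
      𝟙                        ∎
      where open Q².≋-Reasoning

  lift : Q.Series → Q².Series
  lift u i = Q.const (u i)

  lift-cong : ∀ {f g} → f ≋ g → lift f ≋₂ lift g
  lift-cong e = Q².mk λ i → Q.const-cong (at e i)

  lift-const : ∀ c → lift (Q.const c) ≋₂ Q².const (Q.const c)
  lift-const c = Q².mk λ { zero → ≋-refl ; (suc i) → ≋-refl }

  lift-⊕ : ∀ u v → lift (u Q.⊕ v) ≋₂ lift u Q².⊕ lift v
  lift-⊕ u v = Q².mk λ i → Q.const-+ (u i) (v i)

  lift-⊖ : ∀ u v → lift (u Q.⊖ v) ≋₂ lift u Q².⊖ lift v
  lift-⊖ u v = Q².mk λ i → ≋-trans (Q.const-+ (u i) (- v i)) (Q.⊕-cong (≋-refl {Q.const (u i)}) (Q.const-neg (v i)))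

  lift-⊛ : ∀ u v → lift (u Q.⊛ v) ≋₂ lift u Q².⊛ lift v
  lift-⊛ u v = Q².mk λ i → ≋-trans (Q.const-cong (Q.⊛-coeff u v i)) (≋-trans (Q.const-Σ (suc i) _)
    (≋-trans (Q².Σ-cong′ (suc i) (λ a → ≋-sym (Q.const-⊛-const (u a) (v (i ∸ a)))))
      (mk λ j → cong-app (sym (Q².⊛-coeff (lift u) (lift v) i)) j)))

  lift-pow : ∀ u k → lift (Q.pow u k) ≋₂ Q².pow (lift u) k
  lift-pow u zero    = lift-const 1ℚ
  lift-pow u (suc k) = Q².≋-trans (lift-⊛ u _) (Q².⊛-cong Q².≋-refl (lift-pow u k))

  lift-HasOrder : ∀ k u → Q.HasOrder k u → Q².HasOrder k (lift u)
  lift-HasOrder k u o i i<k = Q.const-cong (o i i<k)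

  lift-⊛-const-coeff : ∀ u v i j → (lift u Q².⊛ Q².const v) i j ≡ u i * v j
  lift-⊛-const-coeff u v i j = begin
    (lift u Q².⊛ Q².const v) i j   ≡⟨ at₂ (Q².⊛-comm (lift u) (Q².const v)) i j ⟩
    (Q².const v Q².⊛ lift u) i j   ≡⟨ at₂ (Q².const-⊛ v (lift u)) i j ⟩
    (v Q.⊛ Q.const (u i)) j        ≡⟨ at (Q.⊛-comm v (Q.const (u i))) j ⟩
    (Q.const (u i) Q.⊛ v) j        ≡⟨ at (Q.const-⊛ (u i) v) j ⟩
    u i * v j                      ∎
    where open ≡.≡-Reasoning

  exp2-agrees : ∀ a b → exp2 a b ≋₂ lift (expS a) Q².⊛ Q².const (expS b)
  exp2-agrees a b = mk₂ λ i j → sym (lift-⊛-const-coeff (expS a) (expS b) i j)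

  e^t e^y X·e^y 1-X·e^y : Q².Series
  e^t     = lift eT
  e^y     = Q².const eT
  X·e^y   = lift X Q².⊛ e^y
  1-X·e^y = 𝟙 Q².⊖ X·e^y

  denominator : ℚ → Ser2
  denominator a = const2 1ℚ ⊕₂ exp2 a 0ℚ ⊕₂ exp2 0ℚ 1ℚ ⊖₂ exp2 a 1ℚ

  denominator-factor : denominator 1ℚ ≋₂ lift eᵗ+1 Q².⊛ 1-X·e^y
  denominator-factor = begin
    denominator 1ℚ                                        ≈⟨ Q².⊖-cong (Q².⊕-cong (Q².⊕-cong (const2-agrees 1ℚ) e^t≋) e^y≋)
                                                             (exp2-agrees 1ℚ 1ℚ) ⟩
    𝟙 Q².⊕ e^t Q².⊕ e^y Q².⊖ e^t Q².⊛ e^y               ≈⟨ Q².mk (λ i → mk λ j → regroup (𝟙 i j) (e^t i j) _ _) ⟩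
    (e^t Q².⊕ 𝟙) Q².⊖ (e^t Q².⊛ e^y Q².⊖ e^y)           ≈⟨ Q².⊖-cong (Q².≋-sym lift-eᵗ+1) (Q².≋-sym [eᵗ+1]Xeʸ) ⟩
    lift eᵗ+1 Q².⊖ lift eᵗ+1 Q².⊛ X·e^y                 ≈⟨ Q².⊖-cong (Q².≋-sym (Q².⊛-identityʳ (lift eᵗ+1))) (Q².≋-refl {lift eᵗ+1 Q².⊛ X·e^y}) ⟩
    lift eᵗ+1 Q².⊛ 𝟙 Q².⊖ lift eᵗ+1 Q².⊛ X·e^y          ≈⟨ Q².Ring.x[y-z]≈xy-xz (lift eᵗ+1) 𝟙 X·e^y ⟨
    lift eᵗ+1 Q².⊛ 1-X·e^y                              ∎
    where
    open Q².≋-Reasoning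
    regroup : ∀ a b c d → a + b + c - d ≡ (b + a) - (d - c)
    regroup = solve 4 (λ a b c d → a :+ b :+ c :- d := (b :+ a) :- (d :- c)) refl
      where open +-*-Solver
    lift-eᵗ+1 : lift eᵗ+1 ≋₂ e^t Q².⊕ 𝟙
    lift-eᵗ+1 = Q².≋-trans (lift-⊕ eT (Q.const 1ℚ)) (Q².⊕-cong (Q².≋-refl {e^t}) (lift-const 1ℚ))
    e^t≋ : exp2 1ℚ 0ℚ ≋₂ e^t
    e^t≋ = Q².≋-trans (exp2-agrees 1ℚ 0ℚ) (Q².≋-trans (Q².⊛-cong Q².≋-refl (Q².const-cong expS-0)) (Q².⊛-identityʳ e^t))
    e^y≋ : exp2 0ℚ 1ℚ ≋₂ e^y
    e^y≋ = Q².≋-trans (exp2-agrees 0ℚ 1ℚ)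
      (Q².≋-trans (Q².⊛-cong (Q².≋-trans (lift-cong expS-0) (lift-const 1ℚ)) Q².≋-refl) (Q².⊛-identityˡ e^y))
    [eᵗ+1]Xeʸ : lift eᵗ+1 Q².⊛ X·e^y ≋₂ e^t Q².⊛ e^y Q².⊖ e^y
    [eᵗ+1]Xeʸ = begin
      lift eᵗ+1 Q².⊛ (lift X Q².⊛ e^y)     ≈⟨ Q².⊛-assoc _ _ _ ⟨
      (lift eᵗ+1 Q².⊛ lift X) Q².⊛ e^y     ≈⟨ Q².⊛-cong (Q².≋-sym (lift-⊛ eᵗ+1 X)) Q².≋-refl ⟩
      lift (eᵗ+1 Q.⊛ X) Q².⊛ e^y           ≈⟨ Q².⊛-cong (lift-cong (≋-trans (Q.⊛-comm _ _) X⊛eᵗ+1)) Q².≋-refl ⟩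
      lift (eT Q.⊖ Q.const 1ℚ) Q².⊛ e^y    ≈⟨ Q².⊛-cong (Q².≋-trans (lift-⊖ eT (Q.const 1ℚ))
                                                (Q².⊖-cong (Q².≋-refl {e^t}) (lift-const 1ℚ))) Q².≋-refl ⟩
      (e^t Q².⊖ 𝟙) Q².⊛ e^y                ≈⟨ Q².Ring.[y-z]x≈yx-zx e^y e^t 𝟙 ⟩
      e^t Q².⊛ e^y Q².⊖ 𝟙 Q².⊛ e^y         ≈⟨ Q².⊖-cong (Q².≋-refl {e^t Q².⊛ e^y}) (Q².⊛-identityˡ e^y) ⟩
      e^t Q².⊛ e^y Q².⊖ e^y                ∎

  constℚ : ℚ → Q².Series
  constℚ q = Q².const (Q.const q)

  expY : ℕ → Q².Series
  expY k = Q².const (expS (ℕ→ℚ k))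

  Zterm : (ℕ → ℚ) → ℕ → Q².Series
  Zterm c k = lift (Q.scal (c k) (Q.pow X k)) Q².⊛ expY k

  Z : (ℕ → ℚ) → Q².Series
  Z c = Q².Σ∞ (Zterm c)

  Zterm-HasOrder : ∀ c k → Q².HasOrder k (Zterm c k)
  Zterm-HasOrder c k = ≡.subst (λ q → Q².HasOrder q (Zterm c k)) (ℕP.+-identityʳ k)
    (Q².⊛-HasOrder k 0 {lift (Q.scal (c k) (Q.pow X k))} {expY k} (lift-HasOrder k _ ckXᵏ-HasOrder) (λ i ()))
    where
    ckXᵏ-HasOrder : Q.HasOrder k (Q.scal (c k) (Q.pow X k))
    ckXᵏ-HasOrder i i<k = trans (cong (c k *_) (Q.pow-HasOrder X-HasOrder k i i<k)) (ℚP.*-zeroʳ (c k))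

  Zterm-zero : ∀ c k → c k ≡ 0ℚ → Zterm c k ≋₂ constℚ 0ℚ
  Zterm-zero c k ck≡0 = Q².≋-trans (Q².⊛-cong (Q².≋-trans (lift-cong ckXᵏ≋0) (lift-const 0ℚ)) (Q².≋-refl {expY k}))
    (Q².⊛-zeroˡ (expY k))
    where
    ckXᵏ≋0 : Q.scal (c k) (Q.pow X k) ≋ Q.const 0ℚ
    ckXᵏ≋0 = mk λ i → trans (cong (_* Q.pow X k i) ck≡0) (trans (ℚP.*-zeroˡ (Q.pow X k i)) (sym (Q.const-0# i)))

  Z-cong : ∀ c d → (∀ k → c k ≡ d k) → Z c ≋₂ Z d
  Z-cong c d c≗d = Q².Σ∞-cong (λ k → Q².⊛-cong (lift-cong (mk λ i → cong (_* Q.pow X k i) (c≗d k))) (Q².≋-refl {expY k}))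

  Z-⊖ : ∀ c d → Z c Q².⊖ Z d ≋₂ Z (λ k → c k - d k)
  Z-⊖ c d = Q².≋-sym (Q².≋-trans (Q².Σ∞-cong term)
    (Q².≋-trans (Q².Σ∞-⊕ (Zterm c) (λ k → Q².neg (Zterm d k))) (Q².⊕-cong (Q².≋-refl {Z c}) (Q².Σ∞-neg (Zterm d)))))
    where
    term : ∀ k → Zterm (λ k → c k - d k) k ≋₂ Zterm c k Q².⊖ Zterm d k
    term k = Q².≋-trans (Q².⊛-cong (Q².≋-trans (lift-cong (mk λ i → ℚP.*-distribʳ-+ (Q.pow X k i) (c k) (- d k)))
        (Q².≋-trans (lift-⊕ _ _) (Q².⊕-cong (Q².≋-refl {lift (Q.scal (c k) (Q.pow X k))})
          (Q².≋-trans (lift-cong (mk λ i → sym (ℚP.neg-distribˡ-* (d k) (Q.pow X k i))))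
            (Q².mk λ i → Q.const-neg _))))) (Q².≋-refl {expY k}))
      (Q².Ring.[y-z]x≈yx-zx (expY k) (lift (Q.scal (c k) (Q.pow X k))) (lift (Q.scal (d k) (Q.pow X k))))

  Z-scal : ∀ q c → Z (λ k → q * c k) ≋₂ constℚ q Q².⊛ Z c
  Z-scal q c = Q².≋-sym (Q².≋-trans (Q².⊛-comm (constℚ q) (Z c))
    (Q².≋-trans (Q².Σ∞-⊛ (Zterm c) (constℚ q) (Zterm-HasOrder c)) (Q².Σ∞-cong term)))
    where
    term : ∀ k → Zterm c k Q².⊛ constℚ q ≋₂ Zterm (λ k → q * c k) k
    term k = begin
      (lift A Q².⊛ expY k) Q².⊛ constℚ q            ≈⟨ Q².Ring.xy∙z≈xz∙y (lift A) (expY k) (constℚ q) ⟩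
      (lift A Q².⊛ constℚ q) Q².⊛ expY k            ≈⟨ Q².⊛-cong (Q².⊛-cong (Q².≋-refl {lift A}) (Q².≋-sym (lift-const q)))
                                                        (Q².≋-refl {expY k}) ⟩
      (lift A Q².⊛ lift (Q.const q)) Q².⊛ expY k    ≈⟨ Q².⊛-cong (Q².≋-sym (lift-⊛ A (Q.const q))) (Q².≋-refl {expY k}) ⟩
      lift (A Q.⊛ Q.const q) Q².⊛ expY k            ≈⟨ Q².⊛-cong (lift-cong A⊛q) (Q².≋-refl {expY k}) ⟩
      Zterm (λ k → q * c k) k                       ∎
      where
      open Q².≋-Reasoning
      A = Q.scal (c k) (Q.pow X k)
      A⊛q : A Q.⊛ Q.const q ≋ Q.scal (q * c k) (Q.pow X k)
      A⊛q = ≋-trans (Q.⊛-comm A (Q.const q)) (≋-trans (Q.const-⊛ q A) (mk λ i → sym (ℚP.*-assoc q (c k) (Q.pow X k i))))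

  shift : (ℕ → ℚ) → ℕ → ℚ
  shift c zero    = 0ℚ
  shift c (suc k) = c k

  expY-suc : ∀ k → expY k Q².⊛ e^y ≋₂ expY (suc k)
  expY-suc k = Q².≋-trans (Q².const-⊛-const (expS (ℕ→ℚ k)) eT) (Q².const-cong (≋-trans (expS-+ (ℕ→ℚ k) 1ℚ)
    (≡.subst (λ a → expS (ℕ→ℚ k + 1ℚ) ≋ expS a) (trans (sym (ℕ→ℚ-+ k 1)) (cong ℕ→ℚ (ℕP.+-comm k 1))) ≋-refl)))

  Zterm⊛X·e^y : ∀ c k → Zterm c k Q².⊛ X·e^y ≋₂ Zterm (shift c) (suc k)
  Zterm⊛X·e^y c k = begin
    (lift A Q².⊛ expY k) Q².⊛ (lift X Q².⊛ e^y)    ≈⟨ Q².Ring.*-interchange (lift A) (expY k) (lift X) e^y ⟩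
    (lift A Q².⊛ lift X) Q².⊛ (expY k Q².⊛ e^y)    ≈⟨ Q².⊛-cong (Q².≋-sym (lift-⊛ A X)) (expY-suc k) ⟩
    lift (A Q.⊛ X) Q².⊛ expY (suc k)               ≈⟨ Q².⊛-cong (lift-cong A⊛X) (Q².≋-refl {expY (suc k)}) ⟩
    Zterm (shift c) (suc k)                        ∎
    where
    open Q².≋-Reasoning
    A = Q.scal (c k) (Q.pow X k)
    A⊛X : A Q.⊛ X ≋ Q.scal (c k) (Q.pow X (suc k))
    A⊛X = ≋-trans (≋-sym (Q.scal-⊛ (c k) (Q.pow X k) X)) (Q.scal-cong (c k) (Q.⊛-comm _ _))

  Z⊛X·e^y : ∀ c → Z c Q².⊛ X·e^y ≋₂ Z (shift c)
  Z⊛X·e^y c = Q².≋-trans (Q².Σ∞-⊛ (Zterm c) X·e^y (Zterm-HasOrder c)) (Q².≋-trans (Q².Σ∞-cong (Zterm⊛X·e^y c))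
    (Q².≋-sym (Q².Σ∞-shift (Zterm (shift c)) (Zterm-zero (shift c) 0 refl) (λ k → Zterm-HasOrder (shift c) (suc k)))))

  1-X·e^y⊛Z : ∀ c → 1-X·e^y Q².⊛ Z c ≋₂ Z (λ k → c k - shift c k)
  1-X·e^y⊛Z c = begin
    (𝟙 Q².⊖ X·e^y) Q².⊛ Z c             ≈⟨ Q².Ring.[y-z]x≈yx-zx (Z c) 𝟙 X·e^y ⟩
    𝟙 Q².⊛ Z c Q².⊖ X·e^y Q².⊛ Z c      ≈⟨ Q².⊖-cong (Q².⊛-identityˡ (Z c)) (Q².≋-trans (Q².⊛-comm X·e^y (Z c)) (Z⊛X·e^y c)) ⟩
    Z c Q².⊖ Z (shift c)                ≈⟨ Z-⊖ c (shift c) ⟩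
    Z (λ k → c k - shift c k)           ∎
    where open Q².≋-Reasoning

  δ₁ : ℕ → ℚ
  δ₁ (suc zero) = 1ℚ
  δ₁ _          = 0ℚ

  Z-δ₁ : Z δ₁ ≋₂ X·e^y
  Z-δ₁ = Q².≋-trans (Q².Σ∞-single (Zterm δ₁) others (Zterm-HasOrder δ₁ 1))
    (Q².⊛-cong (lift-cong (mk λ i → trans (ℚP.*-identityˡ _) (at (Q.⊛-identityʳ X) i))) (Q².≋-refl {e^y}))
    where
    others : ∀ k → ¬ (k ≡ 1) → Zterm δ₁ k ≋₂ constℚ 0ℚ
    others zero          _   = Zterm-zero δ₁ 0 refl
    others (suc zero)    k≢1 = ⊥-elim (k≢1 refl)
    others (suc (suc k)) _   = Zterm-zero δ₁ (suc (suc k)) refl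

  -- Zcoeff n k = k (k+1) ⋯ (k+n-1) for k ≥ 1, the coefficients of n! X e^y / (1 - X e^y)^{n+1}.
  Zcoeff : ℕ → ℕ → ℚ
  Zcoeff n zero    = 0ℚ
  Zcoeff n (suc k) = ℕ→ℚ (risingFactorial (suc k) n)

  Zcoeff-suc : ∀ n k → Zcoeff (suc n) k ≡ ℕ→ℚ (risingFactorial k (suc n))
  Zcoeff-suc n zero    = refl
  Zcoeff-suc n (suc k) = refl

  Zcoeff-Δ : ∀ n k → Zcoeff (suc n) k - shift (Zcoeff (suc n)) k ≡ ℕ→ℚ (suc n) * Zcoeff n k
  Zcoeff-Δ n zero    = sym (ℚP.*-zeroʳ (ℕ→ℚ (suc n)))
  Zcoeff-Δ n (suc k) = begin
    ℕ→ℚ (risingFactorial (suc k) (suc n)) - Zcoeff (suc n) k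
      ≡⟨ cong₂ _-_ (trans (cong ℕ→ℚ (risingFactorial-Δ k n)) (ℕ→ℚ-+ r m)) (Zcoeff-suc n k) ⟩
    (ℕ→ℚ r + ℕ→ℚ m) - ℕ→ℚ r
      ≡⟨ solve 2 (λ a b → (a :+ b) :- a := b) refl (ℕ→ℚ r) (ℕ→ℚ m) ⟩
    ℕ→ℚ m
      ≡⟨ ℕ→ℚ-* (suc n) (risingFactorial (suc k) n) ⟩
    ℕ→ℚ (suc n) * Zcoeff n (suc k) ∎
    where
    open ≡.≡-Reasoning
    open +-*-Solver
    r = risingFactorial k (suc n)
    m = suc n ℕ.* risingFactorial (suc k) n

  Zcoeff-Δ-0 : ∀ k → Zcoeff 0 k - shift (Zcoeff 0) k ≡ ℕ→ℚ (0 !) * δ₁ k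
  Zcoeff-Δ-0 zero          = refl
  Zcoeff-Δ-0 (suc zero)    = refl
  Zcoeff-Δ-0 (suc (suc k)) = refl

  [1-X·e^y]^[n+1]⊛Z≋Z[n!δ₁] : ∀ n → Q².pow 1-X·e^y (suc n) Q².⊛ Z (Zcoeff n) ≋₂ Z (λ k → ℕ→ℚ (n !) * δ₁ k)
  [1-X·e^y]^[n+1]⊛Z≋Z[n!δ₁] zero    = Q².≋-trans (Q².⊛-cong (Q².⊛-identityʳ 1-X·e^y) (Q².≋-refl {Z (Zcoeff 0)}))
    (Q².≋-trans (1-X·e^y⊛Z (Zcoeff 0)) (Z-cong _ _ Zcoeff-Δ-0))
  [1-X·e^y]^[n+1]⊛Z≋Z[n!δ₁] (suc n) = begin
    (1-X·e^y Q².⊛ Wⁿ⁺¹) Q².⊛ Z (Zcoeff (suc n))        ≈⟨ Q².⊛-cong (Q².⊛-comm 1-X·e^y Wⁿ⁺¹) Q².≋-refl ⟩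
    (Wⁿ⁺¹ Q².⊛ 1-X·e^y) Q².⊛ Z (Zcoeff (suc n))        ≈⟨ Q².⊛-assoc _ _ _ ⟩
    Wⁿ⁺¹ Q².⊛ (1-X·e^y Q².⊛ Z (Zcoeff (suc n)))        ≈⟨ Q².⊛-cong (Q².≋-refl {Wⁿ⁺¹})
                                                            (Q².≋-trans (1-X·e^y⊛Z (Zcoeff (suc n))) (Z-cong _ _ (Zcoeff-Δ n))) ⟩
    Wⁿ⁺¹ Q².⊛ Z (λ k → ℕ→ℚ (suc n) * Zcoeff n k)      ≈⟨ Q².⊛-cong (Q².≋-refl {Wⁿ⁺¹}) (Z-scal (ℕ→ℚ (suc n)) (Zcoeff n)) ⟩
    Wⁿ⁺¹ Q².⊛ (constℚ (ℕ→ℚ (suc n)) Q².⊛ Z (Zcoeff n)) ≈⟨ Q².Ring.x∙yz≈y∙xz Wⁿ⁺¹ _ _ ⟩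
    constℚ (ℕ→ℚ (suc n)) Q².⊛ (Wⁿ⁺¹ Q².⊛ Z (Zcoeff n)) ≈⟨ Q².⊛-cong (Q².≋-refl {constℚ (ℕ→ℚ (suc n))}) ([1-X·e^y]^[n+1]⊛Z≋Z[n!δ₁] n) ⟩
    constℚ (ℕ→ℚ (suc n)) Q².⊛ Z (λ k → ℕ→ℚ (n !) * δ₁ k) ≈⟨ Z-scal (ℕ→ℚ (suc n)) _ ⟨
    Z (λ k → ℕ→ℚ (suc n) * (ℕ→ℚ (n !) * δ₁ k))          ≈⟨ Z-cong _ _ (λ k → trans (sym (ℚP.*-assoc (ℕ→ℚ (suc n)) (ℕ→ℚ (n !)) (δ₁ k)))
                                                             (cong (_* δ₁ k) (sym (ℕ→ℚ-* (suc n) (n !))))) ⟩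
    Z (λ k → ℕ→ℚ (suc n !) * δ₁ k)                       ∎
    where
    open Q².≋-Reasoning
    Wⁿ⁺¹ = Q².pow 1-X·e^y (suc n)

  ⊛-coeff-00 : ∀ f g → (f Q².⊛ g) 0 0 ≡ f 0 0 * g 0 0
  ⊛-coeff-00 f g = trans (sym (⊛₂-agrees-at f g 0 0)) (trans (ℚP.+-identityˡ _) (ℚP.+-identityˡ (f 0 0 * g 0 0)))

  pow-coeff-00 : ∀ f k → Q².pow f k 0 0 ≡ f 0 0 Q.^ k
  pow-coeff-00 f zero    = refl
  pow-coeff-00 f (suc k) = trans (⊛-coeff-00 f (Q².pow f k)) (cong (f 0 0 *_) (pow-coeff-00 f k))

  pow2-coeff-00-≢0 : ∀ f k → ¬ (f 0 0 ≡ 0ℚ) → ¬ (pow2 f k 0 0 ≡ 0ℚ)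
  pow2-coeff-00-≢0 f k f00≢0 e =
    ^-≢0 (f 0 0) k f00≢0 (trans (sym (pow-coeff-00 f k)) (trans (sym (at₂ (pow2-agrees f k) 0 0)) e))

  fgen-agrees : ∀ a n → fgen a n ≋₂ constℚ (ℕ→ℚ (n !)) Q².⊛ exp2 a 1ℚ Q².⊛ inv2 (pow2 (denominator a) (suc n))
  fgen-agrees a n = Q².≋-trans (scal2-agrees (ℕ→ℚ (n !)) _) (Q².≋-trans (Q².≋-sym (Q².const-⊛ (Q.const (ℕ→ℚ (n !))) _))
    (Q².≋-trans (Q².⊛-cong Q².≋-refl (⊛₂-agrees _ _)) (Q².≋-sym (Q².⊛-assoc _ _ _))))

  denominator^[n+1]-factor : ∀ n →
    pow2 (denominator 1ℚ) (suc n) ≋₂ lift (Q.pow eᵗ+1 (suc n)) Q².⊛ Q².pow 1-X·e^y (suc n)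
  denominator^[n+1]-factor n = Q².≋-trans (pow2-agrees (denominator 1ℚ) (suc n))
    (Q².≋-trans (Q².pow-cong (suc n) denominator-factor) (Q².≋-trans (Q².pow-⊛ (lift eᵗ+1) 1-X·e^y (suc n))
      (Q².⊛-cong (Q².≋-sym (lift-pow eᵗ+1 (suc n))) Q².≋-refl)))

  [1-X·e^y]^[n+1]⊛Z≋n!X·e^y : ∀ n → Q².pow 1-X·e^y (suc n) Q².⊛ Z (Zcoeff n) ≋₂ constℚ (ℕ→ℚ (n !)) Q².⊛ X·e^y
  [1-X·e^y]^[n+1]⊛Z≋n!X·e^y n = Q².≋-trans ([1-X·e^y]^[n+1]⊛Z≋Z[n!δ₁] n)
    (Q².≋-trans (Z-scal (ℕ→ℚ (n !)) δ₁) (Q².⊛-cong (Q².≋-refl {constℚ (ℕ→ℚ (n !))}) Z-δ₁))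

  e^t⊛sinh : ∀ n → e^t Q².⊛ lift sinhS ≋₂ lift (Q.scal ½ (eT+1^1-n n)) Q².⊛ lift (Q.pow eᵗ+1 (suc n)) Q².⊛ lift X
  e^t⊛sinh n = Q².≋-sym (Q².≋-trans (Q².⊛-cong (Q².≋-sym (lift-⊛ _ _)) Q².≋-refl)
    (Q².≋-trans (Q².≋-sym (lift-⊛ _ X)) (Q².≋-trans (lift-cong in-t) (lift-⊛ eT sinhS))))
    where
    in-t : Q.scal ½ (eT+1^1-n n) Q.⊛ Q.pow eᵗ+1 (suc n) Q.⊛ X ≋ eT Q.⊛ sinhS
    in-t = ≋-trans (Q.⊛-cong (≋-sym (Q.scal-⊛ ½ _ _)) (≋-refl {X})) (≋-trans (≋-sym (Q.scal-⊛ ½ _ X))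
      (≋-trans (Q.scal-cong ½ (Q.⊛-cong (eT+1^1-n⊛pow n) (≋-refl {X}))) (≋-sym eᵗ⊛sinh)))

  -- Multiply through by the denominator (e^t+1)^{n+1} (1 - X e^y)^{n+1}.
  f₁⊛sinh : ∀ n → f₁ n Q².⊛ lift sinhS ≋₂ lift (Q.scal ½ (eT+1^1-n n)) Q².⊛ Z (Zcoeff n)
  f₁⊛sinh n = begin
    f₁ n Q².⊛ S                                   ≈⟨ Q².⊛-cong (Q².≋-trans (fgen-agrees 1ℚ n)
                                                        (Q².⊛-cong (Q².⊛-cong (Q².≋-refl {N}) (exp2-agrees 1ℚ 1ℚ)) (Q².≋-refl {V})))
                                                        (Q².≋-refl {S}) ⟩
    ((N Q².⊛ (e^t Q².⊛ e^y)) Q².⊛ V) Q².⊛ S       ≈⟨ CMS.prove 5 (((x₀ ⊗ (x₁ ⊗ x₂)) ⊗ x₃) ⊗ x₄) ((x₀ ⊗ ((x₁ ⊗ x₄) ⊗ x₂)) ⊗ x₃)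
                                                      (N ∷ e^t ∷ e^y ∷ V ∷ S ∷ []) ⟩
    (N Q².⊛ ((e^t Q².⊛ S) Q².⊛ e^y)) Q².⊛ V       ≈⟨ Q².⊛-cong (Q².⊛-cong (Q².≋-refl {N}) (Q².⊛-cong (e^t⊛sinh n) (Q².≋-refl {e^y})))
                                                        (Q².≋-refl {V}) ⟩
    (N Q².⊛ ((A Q².⊛ L Q².⊛ lift X) Q².⊛ e^y)) Q².⊛ V ≈⟨ CMS.prove 5 ((x₀ ⊗ ((x₁ ⊗ x₂) ⊗ x₃)) ⊗ x₄) ((x₁ ⊗ (x₀ ⊗ (x₂ ⊗ x₃))) ⊗ x₄)
                                                         (N ∷ A Q².⊛ L ∷ lift X ∷ e^y ∷ V ∷ []) ⟩
    ((A Q².⊛ L) Q².⊛ (N Q².⊛ X·e^y)) Q².⊛ V        ≈⟨ Q².⊛-cong (Q².⊛-cong (Q².≋-refl {A Q².⊛ L})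
                                                        (Q².≋-sym ([1-X·e^y]^[n+1]⊛Z≋n!X·e^y n))) (Q².≋-refl {V}) ⟩
    ((A Q².⊛ L) Q².⊛ (Wⁿ⁺¹ Q².⊛ Zₙ)) Q².⊛ V        ≈⟨ CMS.prove 5 (((x₀ ⊗ x₁) ⊗ (x₂ ⊗ x₃)) ⊗ x₄) ((x₀ ⊗ x₃) ⊗ ((x₁ ⊗ x₂) ⊗ x₄))
                                                      (A ∷ L ∷ Wⁿ⁺¹ ∷ Zₙ ∷ V ∷ []) ⟩
    (A Q².⊛ Zₙ) Q².⊛ ((L Q².⊛ Wⁿ⁺¹) Q².⊛ V)        ≈⟨ Q².⊛-cong (Q².≋-refl {A Q².⊛ Zₙ})
                                                        (Q².≋-trans (Q².⊛-cong (Q².≋-sym (denominator^[n+1]-factor n)) (Q².≋-refl {V}))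
                                                          (inv2-inverse Dⁿ⁺¹ (pow2-coeff-00-≢0 (denominator 1ℚ) (suc n) λ ()))) ⟩
    (A Q².⊛ Zₙ) Q².⊛ 𝟙                            ≈⟨ Q².⊛-identityʳ _ ⟩
    A Q².⊛ Zₙ                                     ∎
    where
    open Q².≋-Reasoning
    module CMS = Algebra.Solver.CommutativeMonoid (CommutativeRing.*-commutativeMonoid Q².ring)
    open CMS using (var) renaming (_⊕_ to _⊗_)
    x₀ x₁ x₂ x₃ x₄ : CMS.Expr 5
    x₀ = var (# 0)
    x₁ = var (# 1)
    x₂ = var (# 2)
    x₃ = var (# 3)
    x₄ = var (# 4)
    S = lift sinhS
    N = constℚ (ℕ→ℚ (n !))
    Dⁿ⁺¹ = pow2 (denominator 1ℚ) (suc n)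
    V = inv2 Dⁿ⁺¹
    L = lift (Q.pow eᵗ+1 (suc n))
    Wⁿ⁺¹ = Q².pow 1-X·e^y (suc n)
    Zₙ = Z (Zcoeff n)
    A = lift (Q.scal ½ (eT+1^1-n n))

module Coefficients where

  open import Defs
  open RationalLemmas
  open SeriesInT
  open RisingFactorials using (risingFactorial; Σ-stirling1-^)
  open SeriesInTY
  open import Data.Nat as ℕ using (ℕ; zero; suc; _∸_; s≤s; _!) renaming (_≤_ to _≤ℕ_; _<_ to _<ℕ_)
  import Data.Nat.Properties as ℕP
  open import Data.Rational using (ℚ; 0ℚ; 1ℚ; _+_; _*_; -_; _-_)
  open import Data.Rational.Solver using (module +-*-Solver)
  open import Relation.Binary.PropositionalEquality as ≡ using (_≡_; refl; sym; trans; cong; cong₂)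
  open import Relation.Nullary using (¬_)
  open Q using (_≋_; mk; at; ≋-refl; ≋-sym; ≋-trans)
  open Q² using () renaming (_≋_ to _≋₂_)

  yCoeff : Q².Series → ℕ → Q.Series
  yCoeff G l i = G i l

  yCoeff-⊛-lift : ∀ G u l → yCoeff (G Q².⊛ lift u) l ≋ yCoeff G l Q.⊛ u
  yCoeff-⊛-lift G u l = mk λ i → begin
    (G Q².⊛ lift u) i l                                        ≡⟨ sym (⊛₂-agrees-at G (lift u) i l) ⟩
    Σ≤ i (λ a → Σ≤ l (λ b → G a b * lift u (i ∸ a) (l ∸ b)))   ≡⟨ Σ<-agrees (suc i) _ ⟩
    Q.Σ≤ i (λ a → Σ≤ l (λ b → G a b * lift u (i ∸ a) (l ∸ b))) ≡⟨ Q.Σ-cong′ (suc i) (λ a → trans (Σ<-agrees (suc l) _)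
                                                                   (Q.Σ-single (suc l) l _ (ℕP.n<1+n l) (b≢l i a))) ⟩
    Q.Σ≤ i (λ a → G a l * Q.const (u (i ∸ a)) (l ∸ l))         ≡⟨ Q.Σ-cong′ (suc i) (λ a →
                                                                   cong (λ q → G a l * Q.const (u (i ∸ a)) q) (ℕP.n∸n≡0 l)) ⟩
    Q.Σ≤ i (λ a → G a l * u (i ∸ a))                           ≡⟨ sym (Q.⊛-coeff (yCoeff G l) u i) ⟩
    (yCoeff G l Q.⊛ u) i                                       ∎
    where
    open ≡.≡-Reasoning
    const-suc : ∀ x {l b} → b <ℕ l → Q.const x (l ∸ b) ≡ 0ℚ
    const-suc x {suc l} {zero}  _         = refl
    const-suc x {suc l} {suc b} (s≤s b<l) = const-suc x b<l
    b≢l : ∀ i a b → b <ℕ suc l → ¬ (b ≡ l) → G a b * lift u (i ∸ a) (l ∸ b) ≡ 0ℚ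
    b≢l i a b b<1+l b≢l′ = trans (cong (G a b *_) (const-suc (u (i ∸ a)) (ℕP.≤∧≢⇒< (ℕP.≤-pred b<1+l) b≢l′)))
      (ℚP.*-zeroʳ (G a b))

  Z-coeff : ∀ c i l → Z c i l ≡ Q.Σ≤ i (λ k → (c k * Q.pow X k i) * expS (ℕ→ℚ k) l)
  Z-coeff c i l = trans (Σ-coeff² (suc i) (λ k → Zterm c k i) l)
    (Q.Σ-cong′ (suc i) (λ k → lift-⊛-const-coeff (Q.scal (c k) (Q.pow X k)) (expS (ℕ→ℚ k)) i l))

  stirlingLi : ℕ → ℕ → Q.Series
  stirlingLi n l i = Σ≤ n (λ j → ℕ→ℚ (stirling1 n j) * LiNeg (l ℕ.+ j) tanhHalf i)

  -- Σ_j [n j] k^j = k (k+1) ⋯ (k+n-1) collapses the Stirling sum inside each Li_{-(l+j)}.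
  stirlingLi-coeff : ∀ n l i →
    stirlingLi n l i ≡ Q.Σ≤ i (λ k → ((ℕ→ℚ k ^ℚ l) * Q.pow X k i) * ℕ→ℚ (risingFactorial k n))
  stirlingLi-coeff n l i = begin
    Σ≤ n (λ j → s j * LiNeg (l ℕ.+ j) tanhHalf i)                                    ≡⟨ Σ<-agrees (suc n) _ ⟩
    Q.Σ≤ n (λ j → s j * Σ≤ i (λ k → (ℕ→ℚ k ^ℚ (l ℕ.+ j)) * pow tanhHalf k i))         ≡⟨ Q.Σ-cong′ (suc n) (λ j →
                                                                                           trans (cong (s j *_) (Σ<-agrees (suc i) _))
                                                                                                 (Q.Σ-*ˡ (suc i) (s j) _)) ⟩
    Q.Σ≤ n (λ j → Q.Σ≤ i (λ k → s j * ((ℕ→ℚ k ^ℚ (l ℕ.+ j)) * pow tanhHalf k i)))    ≡⟨ Q.Σ-swap (suc n) (suc i) _ ⟩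
    Q.Σ≤ i (λ k → Q.Σ≤ n (λ j → s j * ((ℕ→ℚ k ^ℚ (l ℕ.+ j)) * pow tanhHalf k i)))    ≡⟨ Q.Σ-cong′ (suc i) inner ⟩
    Q.Σ≤ i (λ k → ((ℕ→ℚ k ^ℚ l) * Q.pow X k i) * ℕ→ℚ (risingFactorial k n))          ∎
    where
    open ≡.≡-Reasoning
    s : ℕ → ℚ
    s j = ℕ→ℚ (stirling1 n j)

    ^ℚ-+ : ∀ q a b → q ^ℚ (a ℕ.+ b) ≡ (q ^ℚ a) * (q ^ℚ b)
    ^ℚ-+ q a b = trans (^ℚ-agrees q (a ℕ.+ b))
      (trans (Q.^-homo-* q a b) (cong₂ _*_ (sym (^ℚ-agrees q a)) (sym (^ℚ-agrees q b))))

    inner : ∀ k → Q.Σ≤ n (λ j → s j * ((ℕ→ℚ k ^ℚ (l ℕ.+ j)) * pow tanhHalf k i))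
                ≡ ((ℕ→ℚ k ^ℚ l) * Q.pow X k i) * ℕ→ℚ (risingFactorial k n)
    inner k = begin
      Q.Σ≤ n (λ j → s j * ((ℕ→ℚ k ^ℚ (l ℕ.+ j)) * pow tanhHalf k i))
        ≡⟨ Q.Σ-cong′ (suc n) (λ j → trans (cong₂ (λ u v → s j * (u * v)) (^ℚ-+ (ℕ→ℚ k) l j) Xᵏ-agrees)
             (solve 4 (λ S A B p → S :* ((A :* B) :* p) := (A :* p) :* (S :* B)) refl
               (s j) (ℕ→ℚ k ^ℚ l) (ℕ→ℚ k ^ℚ j) (Q.pow X k i))) ⟩
      Q.Σ≤ n (λ j → ((ℕ→ℚ k ^ℚ l) * Q.pow X k i) * (s j * (ℕ→ℚ k ^ℚ j)))
        ≡⟨ sym (Q.Σ-*ˡ (suc n) ((ℕ→ℚ k ^ℚ l) * Q.pow X k i) (λ j → s j * (ℕ→ℚ k ^ℚ j))) ⟩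
      ((ℕ→ℚ k ^ℚ l) * Q.pow X k i) * Q.Σ≤ n (λ j → s j * (ℕ→ℚ k ^ℚ j))
        ≡⟨ cong (((ℕ→ℚ k ^ℚ l) * Q.pow X k i) *_) (trans (sym (Σ<-agrees (suc n) _)) (Σ-stirling1-^ n k)) ⟩
      ((ℕ→ℚ k ^ℚ l) * Q.pow X k i) * ℕ→ℚ (risingFactorial k n) ∎
      where
      open +-*-Solver
      Xᵏ-agrees : pow tanhHalf k i ≡ Q.pow X k i
      Xᵏ-agrees = at (≋-trans (pow-agrees tanhHalf k) (Q.pow-cong k tanhHalf-agrees)) i

  yCoeff-Z-0 : ∀ n l → yCoeff (Z (Zcoeff n)) l 0 ≡ 0ℚ
  yCoeff-Z-0 n l = trans (Z-coeff (Zcoeff n) 0 l) (trans (ℚP.+-identityˡ _)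
    (trans (cong (_* expS (ℕ→ℚ 0) l) (ℚP.*-zeroˡ (Q.pow X 0 0))) (ℚP.*-zeroˡ (expS (ℕ→ℚ 0) l))))

  -- [y^l] e^{ky} = k^l / l! turns the y^l coefficient of Z into the Stirling-weighted polylogarithms.
  divT-yCoeff-Z : ∀ n l → divT (yCoeff (Z (Zcoeff n)) l) ≋ Q.scal (recip (ℕ→ℚ (l !))) (divT (stirlingLi n l))
  divT-yCoeff-Z n l = mk λ i → trans (Z-coeff (Zcoeff n) (suc i) l) (sym (trans (cong (r *_) (stirlingLi-coeff n l (suc i)))
    (trans (Q.Σ-*ˡ (suc (suc i)) r _) (Q.Σ-cong′ (suc (suc i)) (term i)))))
    where
    open +-*-Solver
    r = recip (ℕ→ℚ (l !))
    term : ∀ i k → r * (((ℕ→ℚ k ^ℚ l) * Q.pow X k (suc i)) * ℕ→ℚ (risingFactorial k n))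
                 ≡ (Zcoeff n k * Q.pow X k (suc i)) * ((ℕ→ℚ k ^ℚ l) * r)
    term i zero    = solve 4 (λ R A F C → R :* ((A :* con 0ℚ) :* F) := (C :* con 0ℚ) :* (A :* R)) refl
      r (0ℚ ^ℚ l) (ℕ→ℚ (risingFactorial 0 n)) (Zcoeff n 0)
    term i (suc k) = solve 4 (λ R A p F → R :* ((A :* p) :* F) := (F :* p) :* (A :* R)) refl
      r (ℕ→ℚ (suc k) ^ℚ l) (Q.pow X (suc k) (suc i)) (ℕ→ℚ (risingFactorial (suc k) n))

  t/sinh : Q.Series
  t/sinh = inv (divT sinhS)

  -- Dividing f₁ sinh t by sinh t = t · (sinh t / t): both sides vanish at t = 0, so the factor t cancels.
  yCoeff-f₁ : ∀ n l →
    yCoeff (f₁ n) l ≋ Q.scal (recip (ℕ→ℚ (l !))) (Q.scal ½ (eT+1^1-n n Q.⊛ (divT (stirlingLi n l) Q.⊛ t/sinh)))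
  yCoeff-f₁ n l = begin
    F                                        ≈⟨ Q.⊛-identityʳ F ⟨
    F Q.⊛ Q.const 1ℚ                         ≈⟨ Q.⊛-cong (≋-refl {F}) (≋-sym (inv-inverse (divT sinhS) λ ())) ⟩
    F Q.⊛ (divT sinhS Q.⊛ t/sinh)            ≈⟨ Q.⊛-assoc F (divT sinhS) t/sinh ⟨
    (F Q.⊛ divT sinhS) Q.⊛ t/sinh            ≈⟨ Q.⊛-cong cancel-t (≋-refl {t/sinh}) ⟩
    (divT Zₗ Q.⊛ A) Q.⊛ t/sinh               ≈⟨ Q.⊛-cong (Q.⊛-cong (divT-yCoeff-Z n l) (≋-refl {A})) (≋-refl {t/sinh}) ⟩
    (Q.scal r (divT G) Q.⊛ A) Q.⊛ t/sinh     ≈⟨ Q.⊛-cong (≋-sym (Q.scal-⊛ r (divT G) A)) (≋-refl {t/sinh}) ⟩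
    Q.scal r (divT G Q.⊛ A) Q.⊛ t/sinh       ≈⟨ Q.scal-⊛ r _ t/sinh ⟨
    Q.scal r ((divT G Q.⊛ A) Q.⊛ t/sinh)     ≈⟨ Q.scal-cong r rearrange ⟩
    Q.scal r (Q.scal ½ (P Q.⊛ (divT G Q.⊛ t/sinh))) ∎
    where
    open Q.≋-Reasoning
    F = yCoeff (f₁ n) l
    Zₗ = yCoeff (Z (Zcoeff n)) l
    G = stirlingLi n l
    P = eT+1^1-n n
    A = Q.scal ½ P
    r = recip (ℕ→ℚ (l !))

    f₁sinh : F Q.⊛ sinhS ≋ Zₗ Q.⊛ A
    f₁sinh = ≋-trans (≋-sym (yCoeff-⊛-lift (f₁ n) sinhS l)) (≋-trans (mk λ i → at₂ (f₁⊛sinh n) i l)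
      (≋-trans (mk λ i → at₂ (Q².⊛-comm (lift A) (Z (Zcoeff n))) i l) (yCoeff-⊛-lift (Z (Zcoeff n)) A l)))

    cancel-t : F Q.⊛ divT sinhS ≋ divT Zₗ Q.⊛ A
    cancel-t = 𝕥⊛-cancel _ _ (≋-trans (Q.Ring.x∙yz≈y∙xz 𝕥 F (divT sinhS)) (≋-trans (Q.⊛-cong (≋-refl {F}) (𝕥⊛divT sinhS refl))
      (≋-trans f₁sinh (≋-trans (Q.⊛-cong (≋-sym (𝕥⊛divT Zₗ (yCoeff-Z-0 n l))) (≋-refl {A})) (Q.⊛-assoc 𝕥 (divT Zₗ) A)))))

    rearrange : (divT G Q.⊛ A) Q.⊛ t/sinh ≋ Q.scal ½ (P Q.⊛ (divT G Q.⊛ t/sinh))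
    rearrange = ≋-trans (Q.⊛-cong (≋-trans (Q.⊛-comm (divT G) A) (≋-sym (Q.scal-⊛ ½ P (divT G)))) (≋-refl {t/sinh}))
      (≋-trans (≋-sym (Q.scal-⊛ ½ _ t/sinh)) (Q.scal-cong ½ (Q.⊛-assoc P (divT G) t/sinh)))

  Aterm-agrees : ∀ L n m → Aterm L n m ≡ ½ * (eT+1^1-n n Q.⊛ (divT (LiNeg L tanhHalf) Q.⊛ t/sinh)) m
  Aterm-agrees L n m = cong (½ *_) (trans (at (⊛-agrees _ _) m) (at (Q.⊛-cong (≋-refl {eT+1^1-n n}) (⊛-agrees _ _)) m))

  Σ-stirling1-Aterm : ∀ n l m → Σ≤ n (λ j → ℕ→ℚ (stirling1 n j) * Aterm (l ℕ.+ j) n m)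
                                ≡ ½ * (eT+1^1-n n Q.⊛ (divT (stirlingLi n l) Q.⊛ t/sinh)) m
  Σ-stirling1-Aterm n l m = begin
    Σ≤ n (λ j → s j * Aterm (l ℕ.+ j) n m)              ≡⟨ Σ<-agrees (suc n) _ ⟩
    Q.Σ≤ n (λ j → s j * Aterm (l ℕ.+ j) n m)            ≡⟨ Q.Σ-cong′ (suc n) (λ j → trans (cong (s j *_) (Aterm-agrees (l ℕ.+ j) n m))
                                                           (Q.x∙yz≈y∙xz (s j) ½ _)) ⟩
    Q.Σ≤ n (λ j → ½ * (s j * (P Q.⊛ Y j) m))            ≡⟨ sym (Q.Σ-*ˡ (suc n) ½ _) ⟩
    ½ * Q.Σ≤ n (λ j → s j * (P Q.⊛ Y j) m)              ≡⟨ cong (½ *_) (Q.Σ-cong′ (suc n) (λ j → cong (s j *_) (at (Q.⊛-comm P (Y j)) m))) ⟩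
    ½ * Q.Σ≤ n (λ j → s j * (Y j Q.⊛ P) m)              ≡⟨ cong (½ *_) (sym (Q.Σ-scal-⊛ (suc n) s Y P m)) ⟩
    ½ * ((λ i → Q.Σ≤ n (λ j → s j * Y j i)) Q.⊛ P) m    ≡⟨ cong (½ *_) (trans (at (Q.⊛-cong ΣsY≋ (≋-refl {P})) m) (at (Q.⊛-comm _ P) m)) ⟩
    ½ * (P Q.⊛ (divT (stirlingLi n l) Q.⊛ t/sinh)) m    ∎
    where
    open ≡.≡-Reasoning
    s : ℕ → ℚ
    s j = ℕ→ℚ (stirling1 n j)
    P = eT+1^1-n n
    Y : ℕ → Q.Series
    Y j = divT (LiNeg (l ℕ.+ j) tanhHalf) Q.⊛ t/sinh
    ΣsY≋ : (λ i → Q.Σ≤ n (λ j → s j * Y j i)) ≋ divT (stirlingLi n l) Q.⊛ t/sinh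
    ΣsY≋ = mk λ i → trans (sym (Q.Σ-scal-⊛ (suc n) s (λ j → divT (LiNeg (l ℕ.+ j) tanhHalf)) t/sinh i))
      (at (Q.⊛-cong (mk λ i′ → sym (Σ<-agrees (suc n) _)) (≋-refl {t/sinh})) i)

  f₁-coeff : ∀ n m l → f₁ n m l ≡ recip (ℕ→ℚ (l !)) * Σ≤ n (λ j → ℕ→ℚ (stirling1 n j) * Aterm (l ℕ.+ j) n m)
  f₁-coeff n m l = trans (at (yCoeff-f₁ n l) m) (cong (recip (ℕ→ℚ (l !)) *_) (sym (Σ-stirling1-Aterm n l m)))

  negArg-coeff² : ∀ f i j → Q².negArg f i j ≡ ((- 1ℚ) ^ℚ i) * f i j
  negArg-coeff² f i j = trans (at (Q.⊛-cong ([-1]^i i) (≋-refl {f i})) j) (at (Q.const-⊛ ((- 1ℚ) ^ℚ i) (f i)) j)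
    where
    [-1]^i : ∀ i → Q.neg (Q.const 1ℚ) Q².^ i ≋ Q.const ((- 1ℚ) ^ℚ i)
    [-1]^i zero    = ≋-refl
    [-1]^i (suc i) = ≋-trans (Q.⊛-cong (≋-sym (Q.const-neg 1ℚ)) ([-1]^i i)) (Q.const-⊛-const (- 1ℚ) ((- 1ℚ) ^ℚ i))

  exp2-neg : ∀ b i j → exp2 (- 1ℚ) b i j ≡ ((- 1ℚ) ^ℚ i) * exp2 1ℚ b i j
  exp2-neg b i j = trans (solve 3 (λ σ r y → σ :* r :* y := σ :* ((con 1ℚ :* r) :* y)) refl ((- 1ℚ) ^ℚ i) (recip (ℕ→ℚ (i !))) y)
    (cong (λ z → ((- 1ℚ) ^ℚ i) * ((z * recip (ℕ→ℚ (i !))) * y)) (sym (1^ℚ i)))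
    where
    open +-*-Solver
    y = (b ^ℚ j) * recip (ℕ→ℚ (j !))
    1^ℚ : ∀ i → 1ℚ ^ℚ i ≡ 1ℚ
    1^ℚ zero    = refl
    1^ℚ (suc i) = trans (ℚP.*-identityˡ (1ℚ ^ℚ i)) (1^ℚ i)

  exp2-0-suc : ∀ b i j → exp2 0ℚ b (suc i) j ≡ 0ℚ
  exp2-0-suc b i j = trans (cong (λ z → z * recip (ℕ→ℚ (suc i !)) * y) (ℚP.*-zeroˡ (0ℚ ^ℚ i)))
    (trans (cong (_* y) (ℚP.*-zeroˡ (recip (ℕ→ℚ (suc i !))))) (ℚP.*-zeroˡ y))
    where y = (b ^ℚ j) * recip (ℕ→ℚ (j !))

  denominator-neg : denominator (- 1ℚ) ≋₂ Q².negArg (denominator 1ℚ)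
  denominator-neg = mk₂ coefficients
    where
    open +-*-Solver
    coefficients : ∀ i j → denominator (- 1ℚ) i j ≡ Q².negArg (denominator 1ℚ) i j
    coefficients zero    j = trans (sym (ℚP.*-identityˡ (denominator 1ℚ 0 j))) (sym (negArg-coeff² (denominator 1ℚ) 0 j))
    coefficients (suc i) j = begin
      ((0ℚ + exp2 (- 1ℚ) 0ℚ (suc i) j) + exp2 0ℚ 1ℚ (suc i) j) - exp2 (- 1ℚ) 1ℚ (suc i) j
        ≡⟨ cong₂ (λ u v → ((0ℚ + u) + v) - exp2 (- 1ℚ) 1ℚ (suc i) j) (exp2-neg 0ℚ (suc i) j) (exp2-0-suc 1ℚ i j) ⟩
      ((0ℚ + σ * a) + 0ℚ) - exp2 (- 1ℚ) 1ℚ (suc i) j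
        ≡⟨ cong (λ v → ((0ℚ + σ * a) + 0ℚ) - v) (exp2-neg 1ℚ (suc i) j) ⟩
      ((0ℚ + σ * a) + 0ℚ) - σ * b
        ≡⟨ solve 3 (λ s a b → ((con 0ℚ :+ s :* a) :+ con 0ℚ) :- s :* b := s :* (((con 0ℚ :+ a) :+ con 0ℚ) :- b)) refl σ a b ⟩
      σ * (((0ℚ + a) + 0ℚ) - b)
        ≡⟨ cong (λ u → σ * (((0ℚ + a) + u) - b)) (sym (exp2-0-suc 1ℚ i j)) ⟩
      σ * denominator 1ℚ (suc i) j
        ≡⟨ sym (negArg-coeff² (denominator 1ℚ) (suc i) j) ⟩
      Q².negArg (denominator 1ℚ) (suc i) j ∎
      where
      open ≡.≡-Reasoning
      σ = (- 1ℚ) ^ℚ suc i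
      a = exp2 1ℚ 0ℚ (suc i) j
      b = exp2 1ℚ 1ℚ (suc i) j

  f₂≋negArg-f₁ : ∀ n → f₂ n ≋₂ Q².negArg (f₁ n)
  f₂≋negArg-f₁ n = begin
    f₂ n                                                                   ≈⟨ fgen-agrees (- 1ℚ) n ⟩
    N Q².⊛ exp2 (- 1ℚ) 1ℚ Q².⊛ inv2 D₂                                      ≈⟨ Q².⊛-cong (Q².⊛-cong
                                                                                 (Q².≋-sym (Q².negArg-const (Q.const (ℕ→ℚ (n !))))) exp2-neg₂)
                                                                                 inv2-D₂ ⟩
    Q².negArg N Q².⊛ Q².negArg (exp2 1ℚ 1ℚ) Q².⊛ Q².negArg (inv2 D₁)       ≈⟨ Q².⊛-cong (Q².≋-sym (Q².negArg-⊛ _ _)) Q².≋-refl ⟩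
    Q².negArg (N Q².⊛ exp2 1ℚ 1ℚ) Q².⊛ Q².negArg (inv2 D₁)                 ≈⟨ Q².negArg-⊛ _ _ ⟨
    Q².negArg (N Q².⊛ exp2 1ℚ 1ℚ Q².⊛ inv2 D₁)                             ≈⟨ Q².negArg-cong (fgen-agrees 1ℚ n) ⟨
    Q².negArg (f₁ n)                                                       ∎
    where
    open Q².≋-Reasoning
    N = constℚ (ℕ→ℚ (n !))
    D₁ = pow2 (denominator 1ℚ) (suc n)
    D₂ = pow2 (denominator (- 1ℚ)) (suc n)

    exp2-neg₂ : exp2 (- 1ℚ) 1ℚ ≋₂ Q².negArg (exp2 1ℚ 1ℚ)
    exp2-neg₂ = mk₂ λ i j → trans (exp2-neg 1ℚ i j) (sym (negArg-coeff² (exp2 1ℚ 1ℚ) i j))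

    D₂≋negArg-D₁ : D₂ ≋₂ Q².negArg D₁
    D₂≋negArg-D₁ = Q².≋-trans (pow2-agrees (denominator (- 1ℚ)) (suc n))
      (Q².≋-trans (Q².pow-cong (suc n) denominator-neg) (Q².≋-trans (Q².≋-sym (Q².negArg-pow (denominator 1ℚ) (suc n)))
        (Q².negArg-cong (Q².≋-sym (pow2-agrees (denominator 1ℚ) (suc n))))))

    inv2-D₂ : inv2 D₂ ≋₂ Q².negArg (inv2 D₁)
    inv2-D₂ = Q².inverse-unique D₂ _ _ (inv2-inverse D₂ (pow2-coeff-00-≢0 (denominator (- 1ℚ)) (suc n) λ ()))
      (Q².≋-trans (Q².⊛-cong D₂≋negArg-D₁ Q².≋-refl)
        (Q².negArg-inverse (inv2-inverse D₁ (pow2-coeff-00-≢0 (denominator 1ℚ) (suc n) λ ()))))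

  f₂-coeff : ∀ n m l → f₂ n m l ≡ ((- 1ℚ) ^ℚ m) * f₁ n m l
  f₂-coeff n m l = trans (at₂ (f₂≋negArg-f₁ n) m l) (negArg-coeff² (f₁ n) m l)

  𝒟-Aterm : ∀ m l n →
    𝒟 m l n ≡ ℕ→ℚ (m !) * ((1ℚ + (- 1ℚ) ^ℚ m) * Σ≤ n (λ j → ℕ→ℚ (stirling1 n j) * Aterm (l ℕ.+ j) n m))
  𝒟-Aterm m l n = trans (Σ<-agrees (suc n) _) (trans (Q.Σ-cong′ (suc n) (λ j →
      solve 4 (λ s M a σ → s :* (M :* (a :+ σ :* a)) := (M :* (con 1ℚ :+ σ)) :* (s :* a)) refl
        (ℕ→ℚ (stirling1 n j)) (ℕ→ℚ (m !)) (Aterm (l ℕ.+ j) n m) σ))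
    (trans (sym (Q.Σ-*ˡ (suc n) (ℕ→ℚ (m !) * (1ℚ + σ)) _))
      (trans (cong ((ℕ→ℚ (m !) * (1ℚ + σ)) *_) (sym (Σ<-agrees (suc n) _))) (ℚP.*-assoc (ℕ→ℚ (m !)) (1ℚ + σ) _))))
    where
    open +-*-Solver
    σ = (- 1ℚ) ^ℚ m

open import Defs
open import Data.Nat using (ℕ)
open import Data.Nat using (_!)
open import Data.Rational using (ℚ; _*_)
open import Relation.Binary.PropositionalEquality using (_≡_)
import Data.Rational.Solver

lemma4p8 : (n m l : ℕ) →
    (f₁ n ⊕₂ f₂ n) m l ≡ 𝒟 m l n * recip (ℕ→ℚ (m !) * ℕ→ℚ (l !))
lemma4p8 n m l = begin
  f₁ n m l + f₂ n m l                    ≡⟨ cong (f₁ n m l +_) (f₂-coeff n m l) ⟩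
  f₁ n m l + σ * f₁ n m l                ≡⟨ cong (λ z → z + σ * z) (f₁-coeff n m l) ⟩
  r * S + σ * (r * S)                    ≡⟨ solve 3 (λ r S σ → r :* S :+ σ :* (r :* S) := ((con 1ℚ :+ σ) :* S) :* r) refl r S σ ⟩
  ((1ℚ + σ) * S) * r                     ≡⟨ sym (*-recip-cancel M _ r (ℕ→ℚ-!≢0 m)) ⟩
  (M * ((1ℚ + σ) * S)) * (recip M * r)   ≡⟨ cong₂ _*_ (sym (𝒟-Aterm m l n)) (sym (recip-*-distrib M _ (ℕ→ℚ-!≢0 m) (ℕ→ℚ-!≢0 l))) ⟩
  𝒟 m l n * recip (M * ℕ→ℚ (l !))       ∎
  where
  open Coefficients
  open RationalLemmas
  open Data.Rational using (1ℚ; _+_; -_)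
  open Data.Rational.Solver.+-*-Solver
  open Relation.Binary.PropositionalEquality using (refl; cong; cong₂; sym)
  open Relation.Binary.PropositionalEquality.≡-Reasoning
  σ = (- 1ℚ) ^ℚ m
  r = recip (ℕ→ℚ (l !))
  M = ℕ→ℚ (m !)
  S = Σ≤ n (λ j → ℕ→ℚ (stirling1 n j) * Aterm (l Data.Nat.+ j) n m)
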